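{- Let $k_1,k_2,k_3\in\mathbb{Z}_{\ge0}$ and let $(X,Y,Z)$ be a $(k_1,k_2,k_3)$-CMM triple associated with the non-labeled cluster $(a,b,c)$. Then: (1) the $(1,2)$-entry of $YZY^{ -1}$ is $\frac{a^2+k_cab+b^2}{c}$ and the $(1,2)$-entry of $Y^{ -1}XY$ is $\frac{b^2+k_abc+c^2}{a}$; (2) $\mathrm{tr}(YZY^{ -1})=-k_c$ and $\mathrm{tr}(Y^{ -1}XY)=-k_a$; (3) $YZY^{ -1},\,Y^{ -1}XY\in SL(2,\mathbb{Z}[x_1^{\pm1},x_2^{\pm1},x_3^{\pm1}])$. In particular, $(X,YZY^{ -1},Y)$ and $(Y,Y^{ -1}XY,Z)$ are $(k_1,k_2,k_3)$-CMM triples.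
   Context: Fix $k_1,k_2,k_3\in\mathbb{Z}_{\ge0}$ and indeterminates $x_1,x_2,x_3$. Mutations: $\mu_1(a,b,c)=(\frac{b^2+k_1bc+c^2}{a},b,c)$, $\mu_2(a,b,c)=(a,\frac{a^2+k_2ac+c^2}{b},c)$, $\mu_3(a,b,c)=(a,b,\frac{a^2+k_3ab+b^2}{c})$. Labeled clusters of $\mathcal{A}(k_1,k_2,k_3)$: triples obtained from $(x_1,x_2,x_3)$ by finitely many mutations; non-labeled clusters: permutations of labeled clusters; cluster variables: entries of labeled clusters. A cluster variable $y$ occurs in a unique position $i$ among labeled clusters, and its parity is $k_y:=k_i$. $\mathscr{M}=\frac{x_1^2+x_2^2+x_3^2+k_1x_2x_3+k_2x_1x_3+k_3x_1x_2}{x_1x_2x_3}$ and $T=\begin{bmatrix}-1&0\\ \mathscr{M}&-1\end{bmatrix}$. A $(k_1,k_2,k_3)$-CMM matrix is $X\in SL(2,\mathbb{Z}[x_1^{\pm1},x_2^{\pm1},x_3^{\pm1}])$ whose $(1,2)$-entry $x_{12}$ is a cluster variable and with $\mathrm{tr}(X)=-k_{x_{12}}$. A $(k_1,k_2,k_3)$-CMM triple is a triple $(X,Y,Z)$ of CMM matrices with $XYZ=T$ such that the triple of $(1,2)$-entries $(x_{12},y_{12},z_{12})$ is a non-labeled cluster; it is said to be associated with that cluster. -}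

module Defs where

open import Data.Nat using (ℕ)
open import Data.Integer as ℤ using (ℤ; +_; -[1+_])
open import Data.List using (List; []; _∷_; _++_; map; concatMap)
open import Data.Fin using (Fin; zero; suc)
open import Data.Fin.Permutation using (Permutation′; _⟨$⟩ʳ_)
open import Data.Product using (Σ; ∃; _×_; _,_)
open import Data.Bool using (if_then_else_; _∧_)
open import Relation.Nullary using (does)
open import Relation.Binary.PropositionalEquality using (_≡_)

-- Laurent polynomials  ℤ[x₁^{±1}, x₂^{±1}, x₃^{±1}]
-- represented as finite formal sums of monomials  c · x₁^e₁ x₂^e₂ x₃^e₃
-- (e_i ∈ ℤ), with equality "same coefficient at every monomial".

record Term : Set where
  constructor term
  field
    cf : ℤ
    e₁ e₂ e₃ : ℤ
open Term

Laurent : Set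
Laurent = List Term

coeff : Laurent → ℤ → ℤ → ℤ → ℤ
coeff [] d₁ d₂ d₃ = + 0
coeff (t ∷ p) d₁ d₂ d₃ =
  if does (e₁ t ℤ.≟ d₁) ∧ does (e₂ t ℤ.≟ d₂) ∧ does (e₃ t ℤ.≟ d₃)
  then cf t ℤ.+ coeff p d₁ d₂ d₃
  else coeff p d₁ d₂ d₃

infix 4 _≈_
_≈_ : Laurent → Laurent → Set
p ≈ q = ∀ d₁ d₂ d₃ → coeff p d₁ d₂ d₃ ≡ coeff q d₁ d₂ d₃

infixl 6 _+_
infixl 7 _*_
_+_ : Laurent → Laurent → Laurent
p + q = p ++ q

tmul : Term → Term → Term
tmul (term a u₁ u₂ u₃) (term b v₁ v₂ v₃) =
  term (a ℤ.* b) (u₁ ℤ.+ v₁) (u₂ ℤ.+ v₂) (u₃ ℤ.+ v₃)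

_*_ : Laurent → Laurent → Laurent
p * q = concatMap (λ s → map (tmul s) q) p

-_ : Laurent → Laurent
- p = map (λ t → term (ℤ.- cf t) (e₁ t) (e₂ t) (e₃ t)) p

cst : ℤ → Laurent
cst z = term z (+ 0) (+ 0) (+ 0) ∷ []

nat : ℕ → Laurent
nat n = cst (+ n)

𝟘 𝟙 : Laurent
𝟘 = []
𝟙 = cst (+ 1)

x₁ x₂ x₃ : Laurent
x₁ = term (+ 1) (+ 1) (+ 0) (+ 0) ∷ []
x₂ = term (+ 1) (+ 0) (+ 1) (+ 0) ∷ []
x₃ = term (+ 1) (+ 0) (+ 0) (+ 1) ∷ []

Params : Set
Params = Fin 3 → ℕ

Triple : Set
Triple = Fin 3 → Laurent

triple : Laurent → Laurent → Laurent → Triple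
triple a b c zero = a
triple a b c (suc zero) = b
triple a b c (suc (suc zero)) = c

quad : ℕ → Laurent → Laurent → Laurent
quad k u v = u * u + nat k * u * v + v * v

-- A mutation in direction i replaces the i-th entry s_i by the
-- (Laurent) element a' with a' · s_i = u² + k_i u v + v²  (u,v the other two
-- entries), i.e. a' = (u² + k_i u v + v²)/s_i.
data Reach (k : Params) : Triple → Set where
  base : Reach k (triple x₁ x₂ x₃)
  mut₁ : ∀ {a b c} a' → Reach k (triple a b c) →
         a' * a ≈ quad (k zero) b c → Reach k (triple a' b c)
  mut₂ : ∀ {a b c} b' → Reach k (triple a b c) →
         b' * b ≈ quad (k (suc zero)) a c → Reach k (triple a b' c)
  mut₃ : ∀ {a b c} c' → Reach k (triple a b c) →
         c' * c ≈ quad (k (suc (suc zero))) a b → Reach k (triple a b c')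

LabeledCluster : Params → Triple → Set
LabeledCluster k t = Σ Triple λ s → Reach k s × (∀ i → s i ≈ t i)

NonLabeledCluster : Params → Triple → Set
NonLabeledCluster k t =
  Σ (Permutation′ 3) λ σ → LabeledCluster k (λ i → t (σ ⟨$⟩ʳ i))

OccursAt : Params → Laurent → Fin 3 → Set
OccursAt k y i = Σ Triple λ t → LabeledCluster k t × t i ≈ y

ClusterVariable : Params → Laurent → Set
ClusterVariable k y = ∃ λ i → OccursAt k y i

-- "k_y = n": y is a cluster variable occurring in position i with k_i = n.
-- (The position is unique, so k_y is well defined.)
Parity : Params → Laurent → ℕ → Set
Parity k y n = ∃ λ i → OccursAt k y i × k i ≡ n

record M2 : Set where
  constructor mat
  field
    m₁₁ m₁₂ m₂₁ m₂₂ : Laurent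
open M2 public

infixl 7 _·_
_·_ : M2 → M2 → M2
mat a b c d · mat a' b' c' d' =
  mat (a * a' + b * c') (a * b' + b * d') (c * a' + d * c') (c * b' + d * d')

infix 4 _≈M_
_≈M_ : M2 → M2 → Set
X ≈M Y = (m₁₁ X ≈ m₁₁ Y) × (m₁₂ X ≈ m₁₂ Y) × (m₂₁ X ≈ m₂₁ Y) × (m₂₂ X ≈ m₂₂ Y)

det : M2 → Laurent
det (mat a b c d) = a * d + - (b * c)

tr : M2 → Laurent
tr (mat a b c d) = a + d

-- inverse of a matrix of determinant 1 (the adjugate)
inv : M2 → M2
inv (mat a b c d) = mat d (- b) (- c) a

InSL2 : M2 → Set
InSL2 X = det X ≈ 𝟙

-- 𝓜 = (x₁²+x₂²+x₃²+k₁x₂x₃+k₂x₁x₃+k₃x₁x₂)/(x₁x₂x₃), written as a Laurent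
-- polynomial: x₁x₂⁻¹x₃⁻¹ + x₁⁻¹x₂x₃⁻¹ + x₁⁻¹x₂⁻¹x₃ + k₁x₁⁻¹ + k₂x₂⁻¹ + k₃x₃⁻¹
𝓜 : Params → Laurent
𝓜 k =
  term (+ 1) (+ 1) -[1+ 0 ] -[1+ 0 ] ∷
  term (+ 1) -[1+ 0 ] (+ 1) -[1+ 0 ] ∷
  term (+ 1) -[1+ 0 ] -[1+ 0 ] (+ 1) ∷
  term (+ k zero) -[1+ 0 ] (+ 0) (+ 0) ∷
  term (+ k (suc zero)) (+ 0) -[1+ 0 ] (+ 0) ∷
  term (+ k (suc (suc zero))) (+ 0) (+ 0) -[1+ 0 ] ∷ []

Tmat : Params → M2
Tmat k = mat (- 𝟙) 𝟘 (𝓜 k) (- 𝟙)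

IsCMM : Params → M2 → Set
IsCMM k X = InSL2 X × ∃ λ n → Parity k (m₁₂ X) n × tr X ≈ - nat n

IsCMMTriple : Params → M2 → M2 → M2 → Set
IsCMMTriple k X Y Z =
  IsCMM k X × IsCMM k Y × IsCMM k Z × (X · Y · Z ≈M Tmat k) ×
  NonLabeledCluster k (triple (m₁₂ X) (m₁₂ Y) (m₁₂ Z))

-- From X Y Z = T one reads off (X Y)₁₂ = Z₁₂ and (Y Z)₁₂ = X₁₂. For 2×2 matrices with det Q = 1,
-- (P Q P⁻¹)₁₂ · Q₁₂ = (P Q)₁₂² − tr Q · (P Q)₁₂ · P₁₂ + P₁₂², and similarly for P⁻¹ Q P, which turns these
-- into the exchange relations c′ c = a² + n_Z a b + b² and a′ a = b² + n_X b c + c² with n = −tr.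
-- Conjugation preserves trace and determinant, and X (Y Z Y⁻¹) Y = Y (Y⁻¹ X Y) Z = X Y Z.
-- It remains to see that these exchanges are mutations, i.e. that n_Z is the parameter k_j of the
-- position j of c in a labeled cluster s presenting (a, b, c). A Fricke identity together with
-- tr (X Y) = −tr Z − 𝓜 c gives 𝓜 a b c = a² + b² + c² + n_X b c + n_Y a c + n_Z a b, while every labeled
-- cluster satisfies the same relation with its own parameters k (Vieta). The products of two entries of
-- s have distinct leading monomials for the lexicographic order, because the leading exponents of a
-- cluster start as the unit vectors and stay linearly independent under X′ = 2 max (U , V) − X; so the
-- two relations force n = k position by position.

module Submission where

open import Defs
open import Data.Nat as ℕ using (ℕ; suc; z≤n; s≤s)
import Data.Nat.Properties as ℕ
open import Data.Integer as ℤ using (ℤ; +_; 0ℤ; 1ℤ; -1ℤ)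
import Data.Integer.Properties as ℤ
open import Data.Integer.Tactic.RingSolver using (solve-∀)
open import Algebra.Solver.Ring.AlmostCommutativeRing using (AlmostCommutativeRing; _-Raw-AlmostCommutative⟶_)
open import Level using (0ℓ)
open import Data.Maybe using (Maybe; just; nothing)
open import Data.List using ([]; _∷_; _++_; map; length)
open import Data.Product using (∃; _×_; _,_; proj₁; proj₂)
open import Function using (id; _∘_; _$_)
open import Data.Fin as Fin using (Fin)
open import Data.Fin.Patterns using (0F; 1F; 2F)
open import Data.Fin.Permutation using (Permutation′; _⟨$⟩ʳ_; _⟨$⟩ˡ_; inverseˡ; inverseʳ; _∘ₚ_; transpose)
open import Data.Bool using (Bool; true; false; if_then_else_; _∧_)
open import Relation.Nullary using (does; yes; no; ¬_; contradiction)
open import Relation.Nullary.Decidable using (dec-true; decidable-stable)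
open import Data.List.Relation.Unary.Any using (Any; here; there)
open import Relation.Binary.PropositionalEquality
open import Data.Sum using (_⊎_; inj₁; inj₂; [_,_]′)
open import Relation.Binary.Definitions using (Trichotomous; Tri; tri<; tri≈; tri>)
open import Relation.Binary.Bundles using (Setoid)
import Relation.Binary.Reasoning.Setoid as ≈-Reasoning
open import Data.Vec.N-ary using (N-ary)

open Term using (cf)

Exponent : Set
Exponent = ℤ × ℤ × ℤ

exponent : Term → Exponent
exponent t = Term.e₁ t , Term.e₂ t , Term.e₃ t

infixl 6 _+ᵉ_ _-ᵉ_

_+ᵉ_ : Exponent → Exponent → Exponent
(a , b , c) +ᵉ (d , e , f) = a ℤ.+ d , b ℤ.+ e , c ℤ.+ f

_-ᵉ_ : Exponent → Exponent → Exponent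
(a , b , c) -ᵉ (d , e , f) = a ℤ.- d , b ℤ.- e , c ℤ.- f

0ᵉ : Exponent
0ᵉ = 0ℤ , 0ℤ , 0ℤ

triple-≡ : ∀ {a b c a' b' c' : ℤ} → a ≡ a' → b ≡ b' → c ≡ c' → (a , b , c) ≡ (a' , b' , c')
triple-≡ refl refl refl = refl

+ᵉ-comm : ∀ d e → d +ᵉ e ≡ e +ᵉ d
+ᵉ-comm (a , b , c) (d , e , f) = triple-≡ (ℤ.+-comm a d) (ℤ.+-comm b e) (ℤ.+-comm c f)

+ᵉ-assoc : ∀ d e f → d +ᵉ e +ᵉ f ≡ d +ᵉ (e +ᵉ f)
+ᵉ-assoc (a , b , c) (a' , b' , c') (a'' , b'' , c'') =
  triple-≡ (ℤ.+-assoc a a' a'') (ℤ.+-assoc b b' b'') (ℤ.+-assoc c c' c'')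

+ᵉ-identityˡ : ∀ d → 0ᵉ +ᵉ d ≡ d
+ᵉ-identityˡ (a , b , c) = triple-≡ (ℤ.+-identityˡ a) (ℤ.+-identityˡ b) (ℤ.+-identityˡ c)

-ᵉ+ᵉ-cancel : ∀ d e → d -ᵉ e +ᵉ e ≡ d
-ᵉ+ᵉ-cancel (a , b , c) (d , e , f) = triple-≡ (cancel a d) (cancel b e) (cancel c f)
  where cancel : ∀ x y → x ℤ.- y ℤ.+ y ≡ x
        cancel = solve-∀

+ᵉ--ᵉ-cancel : ∀ d e → d +ᵉ e -ᵉ d ≡ e
+ᵉ--ᵉ-cancel (a , b , c) (d , e , f) = triple-≡ (cancel a d) (cancel b e) (cancel c f)
  where cancel : ∀ x y → x ℤ.+ y ℤ.- x ≡ y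
        cancel = solve-∀

+ᵉ--ᵉ-cancelʳ : ∀ d f → d +ᵉ f +ᵉ (0ᵉ -ᵉ f) ≡ d
+ᵉ--ᵉ-cancelʳ (a , b , c) (d , e , f) = triple-≡ (cancel a d) (cancel b e) (cancel c f)
  where cancel : ∀ x y → x ℤ.+ y ℤ.+ (0ℤ ℤ.- y) ≡ x
        cancel = solve-∀

-ᵉ-identityʳ : ∀ d → d -ᵉ 0ᵉ ≡ d
-ᵉ-identityʳ (a , b , c) = triple-≡ (ℤ.+-identityʳ a) (ℤ.+-identityʳ b) (ℤ.+-identityʳ c)

+ᵉ-cancelʳ-≡ : ∀ {d e} f → d +ᵉ f ≡ e +ᵉ f → d ≡ e
+ᵉ-cancelʳ-≡ {d} {e} f eq = trans (sym (+ᵉ--ᵉ-cancelʳ d f)) (trans (cong (_+ᵉ (0ᵉ -ᵉ f)) eq) (+ᵉ--ᵉ-cancelʳ e f))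

-- The test used by `coeff`, so that `coeffᵉ` below unfolds through it.
infix 4 _==ᵉ_
_==ᵉ_ : Exponent → Exponent → Bool
(a , b , c) ==ᵉ (a' , b' , c') = does (a ℤ.≟ a') ∧ does (b ℤ.≟ b') ∧ does (c ℤ.≟ c')

==ᵉ⇒≡ : ∀ {e d} → (e ==ᵉ d) ≡ true → e ≡ d
==ᵉ⇒≡ {a , b , c} {a' , b' , c'} eq with a ℤ.≟ a' | b ℤ.≟ b' | c ℤ.≟ c'
==ᵉ⇒≡ {a , b , c} {a' , b' , c'} eq  | yes refl | yes refl | yes refl = refl
==ᵉ⇒≡ {a , b , c} {a' , b' , c'} () | no _     | _        | _
==ᵉ⇒≡ {a , b , c} {a' , b' , c'} () | yes _    | no _     | _
==ᵉ⇒≡ {a , b , c} {a' , b' , c'} () | yes _    | yes _    | no _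

==ᵉ-refl : ∀ e → (e ==ᵉ e) ≡ true
==ᵉ-refl (a , b , c)
  rewrite dec-true (a ℤ.≟ a) refl | dec-true (b ℤ.≟ b) refl | dec-true (c ℤ.≟ c) refl = refl

≢⇒==ᵉ-false : ∀ {e d} → e ≢ d → (e ==ᵉ d) ≡ false
≢⇒==ᵉ-false {e} {d} e≢d with e ==ᵉ d in eq
... | true  = contradiction (==ᵉ⇒≡ eq) e≢d
... | false = refl

does-≟-shift : ∀ x y z → does (x ℤ.+ y ℤ.≟ z) ≡ does (y ℤ.≟ z ℤ.- x)
does-≟-shift x y z with x ℤ.+ y ℤ.≟ z | y ℤ.≟ z ℤ.- x
... | yes _ | yes _ = refl
... | no _  | no _  = refl
... | yes x+y≡z | no y≢z-x = contradiction (trans (sym (+-cancel x y)) (cong (ℤ._- x) x+y≡z)) y≢z-x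
  where +-cancel : ∀ x y → x ℤ.+ y ℤ.- x ≡ y
        +-cancel = solve-∀
... | no x+y≢z | yes y≡z-x = contradiction (trans (cong (λ w → x ℤ.+ w) y≡z-x) (+-cancel x z)) x+y≢z
  where +-cancel : ∀ x z → x ℤ.+ (z ℤ.- x) ≡ z
        +-cancel = solve-∀

==ᵉ-shift : ∀ e e' d → (e +ᵉ e' ==ᵉ d) ≡ (e' ==ᵉ d -ᵉ e)
==ᵉ-shift (a , b , c) (a' , b' , c') (d₁ , d₂ , d₃)
  rewrite does-≟-shift a a' d₁ | does-≟-shift b b' d₂ | does-≟-shift c c' d₃ = refl

δ : Exponent → Exponent → ℤ
δ d e = if e ==ᵉ d then 1ℤ else 0ℤ

δ-diag : ∀ d → δ d d ≡ 1ℤ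
δ-diag d rewrite ==ᵉ-refl d = refl

δ-off : ∀ {d e} → e ≢ d → δ d e ≡ 0ℤ
δ-off e≢d rewrite ≢⇒==ᵉ-false e≢d = refl

coeffᵉ : Laurent → Exponent → ℤ
coeffᵉ p (d₁ , d₂ , d₃) = coeff p d₁ d₂ d₃

⟨_∣_⟩ : Laurent → (Exponent → ℤ) → ℤ
⟨ [] ∣ g ⟩ = 0ℤ
⟨ t ∷ p ∣ g ⟩ = cf t ℤ.* g (exponent t) ℤ.+ ⟨ p ∣ g ⟩

coeff≡pairing-δ : ∀ p d → coeffᵉ p d ≡ ⟨ p ∣ δ d ⟩
coeff≡pairing-δ [] d = refl
coeff≡pairing-δ (t ∷ p) d with exponent t ==ᵉ d
... | true  = cong₂ ℤ._+_ (sym (ℤ.*-identityʳ (cf t))) (coeff≡pairing-δ p d)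
... | false = begin
  coeffᵉ p d                    ≡⟨ coeff≡pairing-δ p d ⟩
  ⟨ p ∣ δ d ⟩                    ≡⟨ ℤ.+-identityˡ _ ⟨
  0ℤ ℤ.+ ⟨ p ∣ δ d ⟩             ≡⟨ cong (ℤ._+ ⟨ p ∣ δ d ⟩) (ℤ.*-zeroʳ (cf t)) ⟨
  cf t ℤ.* 0ℤ ℤ.+ ⟨ p ∣ δ d ⟩    ∎
  where open ≡-Reasoning

pairing-++ : ∀ p q g → ⟨ p ++ q ∣ g ⟩ ≡ ⟨ p ∣ g ⟩ ℤ.+ ⟨ q ∣ g ⟩
pairing-++ [] q g = sym (ℤ.+-identityˡ _)
pairing-++ (t ∷ p) q g rewrite pairing-++ p q g = sym (ℤ.+-assoc (cf t ℤ.* g (exponent t)) ⟨ p ∣ g ⟩ ⟨ q ∣ g ⟩)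

pairing-neg : ∀ p g → ⟨ - p ∣ g ⟩ ≡ ℤ.- ⟨ p ∣ g ⟩
pairing-neg [] g = refl
pairing-neg (t ∷ p) g rewrite pairing-neg p g = identity (cf t) (g (exponent t)) ⟨ p ∣ g ⟩
  where identity : ∀ c x r → ℤ.- c ℤ.* x ℤ.+ ℤ.- r ≡ ℤ.- (c ℤ.* x ℤ.+ r)
        identity = solve-∀

pairing-congʳ : ∀ p {g h} → (∀ e → g e ≡ h e) → ⟨ p ∣ g ⟩ ≡ ⟨ p ∣ h ⟩
pairing-congʳ [] g≗h = refl
pairing-congʳ (t ∷ p) g≗h = cong₂ ℤ._+_ (cong (cf t ℤ.*_) (g≗h (exponent t))) (pairing-congʳ p g≗h)

pairing-scaleʳ : ∀ p α g → ⟨ p ∣ (λ e → α ℤ.* g e) ⟩ ≡ α ℤ.* ⟨ p ∣ g ⟩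
pairing-scaleʳ [] α g = sym (ℤ.*-zeroʳ α)
pairing-scaleʳ (t ∷ p) α g rewrite pairing-scaleʳ p α g = identity (cf t) α (g (exponent t)) ⟨ p ∣ g ⟩
  where identity : ∀ c α x r → c ℤ.* (α ℤ.* x) ℤ.+ α ℤ.* r ≡ α ℤ.* (c ℤ.* x ℤ.+ r)
        identity = solve-∀

pairing-+ʳ : ∀ p g h → ⟨ p ∣ (λ e → g e ℤ.+ h e) ⟩ ≡ ⟨ p ∣ g ⟩ ℤ.+ ⟨ p ∣ h ⟩
pairing-+ʳ [] g h = refl
pairing-+ʳ (t ∷ p) g h rewrite pairing-+ʳ p g h =
  identity (cf t) (g (exponent t)) (h (exponent t)) ⟨ p ∣ g ⟩ ⟨ p ∣ h ⟩
  where identity : ∀ c x y r s → c ℤ.* (x ℤ.+ y) ℤ.+ (r ℤ.+ s) ≡ c ℤ.* x ℤ.+ r ℤ.+ (c ℤ.* y ℤ.+ s)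
        identity = solve-∀

pairing-0ʳ : ∀ p → ⟨ p ∣ (λ _ → 0ℤ) ⟩ ≡ 0ℤ
pairing-0ʳ [] = refl
pairing-0ʳ (t ∷ p) rewrite pairing-0ʳ p = trans (ℤ.+-identityʳ _) (ℤ.*-zeroʳ (cf t))

pairing-* : ∀ p q g → ⟨ p * q ∣ g ⟩ ≡ ⟨ p ∣ (λ e → ⟨ q ∣ (λ e' → g (e +ᵉ e')) ⟩) ⟩
pairing-* [] q g = refl
pairing-* (s ∷ p) q g = trans (pairing-++ (map (tmul s) q) (p * q) g)
                              (cong₂ ℤ._+_ (pairing-map s q) (pairing-* p q g))
  where
  pairing-map : ∀ s q → ⟨ map (tmul s) q ∣ g ⟩ ≡ cf s ℤ.* ⟨ q ∣ (λ e → g (exponent s +ᵉ e)) ⟩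
  pairing-map s [] = sym (ℤ.*-zeroʳ (cf s))
  pairing-map s (t ∷ q) rewrite pairing-map s q =
    identity (cf s) (cf t) (g (exponent s +ᵉ exponent t)) ⟨ q ∣ (λ e → g (exponent s +ᵉ e)) ⟩
    where identity : ∀ a b x r → a ℤ.* b ℤ.* x ℤ.+ a ℤ.* r ≡ a ℤ.* (b ℤ.* x ℤ.+ r)
          identity = solve-∀

pairing-swap : ∀ p q (h : Exponent → Exponent → ℤ) →
               ⟨ p ∣ (λ e → ⟨ q ∣ h e ⟩) ⟩ ≡ ⟨ q ∣ (λ e' → ⟨ p ∣ (λ e → h e e') ⟩) ⟩
pairing-swap [] q h = sym (pairing-0ʳ q)
pairing-swap (t ∷ p) q h = begin
  cf t ℤ.* ⟨ q ∣ h (exponent t) ⟩ ℤ.+ ⟨ p ∣ (λ e → ⟨ q ∣ h e ⟩) ⟩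
    ≡⟨ cong₂ ℤ._+_ (sym (pairing-scaleʳ q (cf t) (h (exponent t)))) (pairing-swap p q h) ⟩
  ⟨ q ∣ (λ e' → cf t ℤ.* h (exponent t) e') ⟩ ℤ.+ ⟨ q ∣ (λ e' → ⟨ p ∣ (λ e → h e e') ⟩) ⟩
    ≡⟨ pairing-+ʳ q _ _ ⟨
  ⟨ q ∣ (λ e' → cf t ℤ.* h (exponent t) e' ℤ.+ ⟨ p ∣ (λ e → h e e') ⟩) ⟩ ∎
  where open ≡-Reasoning

-- The ring of Laurent polynomials

-- A record rather than `_≈_` of Defs, so that both sides can be inferred from a proof.
infix 4 _≋_
record _≋_ (p q : Laurent) : Set where
  constructor mk≋
  field coeff-≡ : ∀ d → coeffᵉ p d ≡ coeffᵉ q d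
open _≋_ public

≋-refl : ∀ {p} → p ≋ p
≋-refl = mk≋ (λ _ → refl)

≋-sym : ∀ {p q} → p ≋ q → q ≋ p
≋-sym (mk≋ eq) = mk≋ (λ d → sym (eq d))

≋-trans : ∀ {p q r} → p ≋ q → q ≋ r → p ≋ r
≋-trans (mk≋ eq) (mk≋ eq') = mk≋ (λ d → trans (eq d) (eq' d))

≡⇒≋ : ∀ {p q} → p ≡ q → p ≋ q
≡⇒≋ refl = ≋-refl

≋⇒≈ : ∀ {p q} → p ≋ q → p ≈ q
≋⇒≈ (mk≋ eq) d₁ d₂ d₃ = eq (d₁ , d₂ , d₃)

≈⇒≋ : ∀ {p q} → p ≈ q → p ≋ q
≈⇒≋ eq = mk≋ (λ (d₁ , d₂ , d₃) → eq d₁ d₂ d₃)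

coeff-+ : ∀ p q d → coeffᵉ (p + q) d ≡ coeffᵉ p d ℤ.+ coeffᵉ q d
coeff-+ p q d = begin
  coeffᵉ (p ++ q) d                    ≡⟨ coeff≡pairing-δ (p ++ q) d ⟩
  ⟨ p ++ q ∣ δ d ⟩                     ≡⟨ pairing-++ p q (δ d) ⟩
  ⟨ p ∣ δ d ⟩ ℤ.+ ⟨ q ∣ δ d ⟩          ≡⟨ cong₂ ℤ._+_ (coeff≡pairing-δ p d) (coeff≡pairing-δ q d) ⟨
  coeffᵉ p d ℤ.+ coeffᵉ q d            ∎
  where open ≡-Reasoning

coeff-neg : ∀ p d → coeffᵉ (- p) d ≡ ℤ.- coeffᵉ p d
coeff-neg p d = begin
  coeffᵉ (- p) d       ≡⟨ coeff≡pairing-δ (- p) d ⟩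
  ⟨ - p ∣ δ d ⟩        ≡⟨ pairing-neg p (δ d) ⟩
  ℤ.- ⟨ p ∣ δ d ⟩      ≡⟨ cong ℤ.-_ (coeff≡pairing-δ p d) ⟨
  ℤ.- coeffᵉ p d       ∎
  where open ≡-Reasoning

coeff-* : ∀ p q d → coeffᵉ (p * q) d ≡ ⟨ p ∣ (λ e → ⟨ q ∣ (λ e' → δ d (e +ᵉ e')) ⟩) ⟩
coeff-* p q d = trans (coeff≡pairing-δ (p * q) d) (pairing-* p q (δ d))

coeff-*ʳ : ∀ p q d → coeffᵉ (p * q) d ≡ ⟨ p ∣ (λ e → coeffᵉ q (d -ᵉ e)) ⟩
coeff-*ʳ p q d = trans (coeff-* p q d) (pairing-congʳ p λ e →
  trans (pairing-congʳ q (λ e' → cong (λ b → if b then 1ℤ else 0ℤ) (==ᵉ-shift e e' d)))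
        (sym (coeff≡pairing-δ q (d -ᵉ e))))

coeff-*ˡ : ∀ p q d → coeffᵉ (p * q) d ≡ ⟨ q ∣ (λ e' → coeffᵉ p (d -ᵉ e')) ⟩
coeff-*ˡ p q d = trans (coeff-* p q d) (trans (pairing-swap p q _) (pairing-congʳ q λ e' →
  trans (pairing-congʳ p (λ e → cong (λ b → if b then 1ℤ else 0ℤ)
                                   (trans (cong (_==ᵉ d) (+ᵉ-comm e e')) (==ᵉ-shift e' e d))))
        (sym (coeff≡pairing-δ p (d -ᵉ e')))))

+-cong : ∀ {p p' q q'} → p ≋ p' → q ≋ q' → p + q ≋ p' + q'
+-cong {p} {p'} {q} {q'} (mk≋ eq) (mk≋ eq') = mk≋ λ d →
  trans (coeff-+ p q d) (trans (cong₂ ℤ._+_ (eq d) (eq' d)) (sym (coeff-+ p' q' d)))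

+-assoc : ∀ p q r → p + q + r ≋ p + (q + r)
+-assoc p q r = mk≋ λ d → begin
  coeffᵉ (p + q + r) d                            ≡⟨ coeff-+ (p + q) r d ⟩
  coeffᵉ (p + q) d ℤ.+ coeffᵉ r d                 ≡⟨ cong (ℤ._+ coeffᵉ r d) (coeff-+ p q d) ⟩
  coeffᵉ p d ℤ.+ coeffᵉ q d ℤ.+ coeffᵉ r d        ≡⟨ ℤ.+-assoc (coeffᵉ p d) (coeffᵉ q d) (coeffᵉ r d) ⟩
  coeffᵉ p d ℤ.+ (coeffᵉ q d ℤ.+ coeffᵉ r d)      ≡⟨ cong (λ w → coeffᵉ p d ℤ.+ w) (coeff-+ q r d) ⟨
  coeffᵉ p d ℤ.+ coeffᵉ (q + r) d                 ≡⟨ coeff-+ p (q + r) d ⟨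
  coeffᵉ (p + (q + r)) d                          ∎
  where open ≡-Reasoning

+-comm : ∀ p q → p + q ≋ q + p
+-comm p q = mk≋ λ d →
  trans (coeff-+ p q d) (trans (ℤ.+-comm (coeffᵉ p d) (coeffᵉ q d)) (sym (coeff-+ q p d)))

+-identityʳ : ∀ p → p + 𝟘 ≋ p
+-identityʳ p = mk≋ λ d → trans (coeff-+ p 𝟘 d) (ℤ.+-identityʳ (coeffᵉ p d))

-‿cong : ∀ {p q} → p ≋ q → - p ≋ - q
-‿cong {p} {q} (mk≋ eq) = mk≋ λ d → trans (coeff-neg p d) (trans (cong ℤ.-_ (eq d)) (sym (coeff-neg q d)))

-‿+-comm : ∀ p q → - p + - q ≋ - (p + q)
-‿+-comm p q = mk≋ λ d → begin
  coeffᵉ (- p + - q) d                      ≡⟨ coeff-+ (- p) (- q) d ⟩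
  coeffᵉ (- p) d ℤ.+ coeffᵉ (- q) d         ≡⟨ cong₂ ℤ._+_ (coeff-neg p d) (coeff-neg q d) ⟩
  ℤ.- coeffᵉ p d ℤ.+ ℤ.- coeffᵉ q d         ≡⟨ ℤ.neg-distrib-+ (coeffᵉ p d) (coeffᵉ q d) ⟨
  ℤ.- (coeffᵉ p d ℤ.+ coeffᵉ q d)           ≡⟨ cong ℤ.-_ (coeff-+ p q d) ⟨
  ℤ.- coeffᵉ (p + q) d                      ≡⟨ coeff-neg (p + q) d ⟨
  coeffᵉ (- (p + q)) d                      ∎
  where open ≡-Reasoning

*-congˡ : ∀ {p p'} q → p ≋ p' → p * q ≋ p' * q
*-congˡ {p} {p'} q (mk≋ eq) = mk≋ λ d →
  trans (coeff-*ˡ p q d) (trans (pairing-congʳ q (λ e → eq (d -ᵉ e))) (sym (coeff-*ˡ p' q d)))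

*-congʳ : ∀ p {q q'} → q ≋ q' → p * q ≋ p * q'
*-congʳ p {q} {q'} (mk≋ eq) = mk≋ λ d →
  trans (coeff-*ʳ p q d) (trans (pairing-congʳ p (λ e → eq (d -ᵉ e))) (sym (coeff-*ʳ p q' d)))

*-cong : ∀ {p p' q q'} → p ≋ p' → q ≋ q' → p * q ≋ p' * q'
*-cong {p} {p'} {q} {q'} p≋p' q≋q' = ≋-trans (*-congˡ q p≋p') (*-congʳ p' q≋q')

*-comm : ∀ p q → p * q ≋ q * p
*-comm p q = mk≋ λ d → trans (coeff-* p q d) (trans (pairing-swap p q _)
  (trans (pairing-congʳ q (λ e' → pairing-congʳ p (λ e → cong (δ d) (+ᵉ-comm e e')))) (sym (coeff-* q p d))))

*-assoc : ∀ p q r → p * q * r ≋ p * (q * r)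
*-assoc p q r = mk≋ λ d → begin
  coeffᵉ (p * q * r) d
    ≡⟨ trans (coeff-* (p * q) r d) (pairing-* p q _) ⟩
  ⟨ p ∣ (λ e₁ → ⟨ q ∣ (λ e₂ → ⟨ r ∣ (λ e₃ → δ d (e₁ +ᵉ e₂ +ᵉ e₃)) ⟩) ⟩) ⟩
    ≡⟨ pairing-congʳ p (λ e₁ → pairing-congʳ q (λ e₂ → pairing-congʳ r (λ e₃ →
         cong (δ d) (+ᵉ-assoc e₁ e₂ e₃)))) ⟩
  ⟨ p ∣ (λ e₁ → ⟨ q ∣ (λ e₂ → ⟨ r ∣ (λ e₃ → δ d (e₁ +ᵉ (e₂ +ᵉ e₃))) ⟩) ⟩) ⟩
    ≡⟨ pairing-congʳ p (λ e₁ → pairing-* q r (λ e → δ d (e₁ +ᵉ e))) ⟨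
  ⟨ p ∣ (λ e₁ → ⟨ q * r ∣ (λ e → δ d (e₁ +ᵉ e)) ⟩) ⟩
    ≡⟨ coeff-* p (q * r) d ⟨
  coeffᵉ (p * (q * r)) d ∎
  where open ≡-Reasoning

*-identityˡ : ∀ p → 𝟙 * p ≋ p
*-identityˡ p = mk≋ λ d → begin
  coeffᵉ (𝟙 * p) d                                   ≡⟨ coeff-* 𝟙 p d ⟩
  1ℤ ℤ.* ⟨ p ∣ (λ e → δ d (0ᵉ +ᵉ e)) ⟩ ℤ.+ 0ℤ        ≡⟨ trans (ℤ.+-identityʳ _) (ℤ.*-identityˡ _) ⟩
  ⟨ p ∣ (λ e → δ d (0ᵉ +ᵉ e)) ⟩                      ≡⟨ pairing-congʳ p (λ e → cong (δ d) (+ᵉ-identityˡ e)) ⟩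
  ⟨ p ∣ δ d ⟩                                        ≡⟨ coeff≡pairing-δ p d ⟨
  coeffᵉ p d                                         ∎
  where open ≡-Reasoning

*-identityʳ : ∀ p → p * 𝟙 ≋ p
*-identityʳ p = ≋-trans (*-comm p 𝟙) (*-identityˡ p)

*-distribˡ-+ : ∀ p q r → p * (q + r) ≋ p * q + p * r
*-distribˡ-+ p q r = mk≋ λ d → begin
  coeffᵉ (p * (q + r)) d
    ≡⟨ coeff-*ʳ p (q + r) d ⟩
  ⟨ p ∣ (λ e → coeffᵉ (q + r) (d -ᵉ e)) ⟩
    ≡⟨ pairing-congʳ p (λ e → coeff-+ q r (d -ᵉ e)) ⟩
  ⟨ p ∣ (λ e → coeffᵉ q (d -ᵉ e) ℤ.+ coeffᵉ r (d -ᵉ e)) ⟩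
    ≡⟨ pairing-+ʳ p _ _ ⟩
  ⟨ p ∣ (λ e → coeffᵉ q (d -ᵉ e)) ⟩ ℤ.+ ⟨ p ∣ (λ e → coeffᵉ r (d -ᵉ e)) ⟩
    ≡⟨ cong₂ ℤ._+_ (coeff-*ʳ p q d) (coeff-*ʳ p r d) ⟨
  coeffᵉ (p * q) d ℤ.+ coeffᵉ (p * r) d
    ≡⟨ coeff-+ (p * q) (p * r) d ⟨
  coeffᵉ (p * q + p * r) d ∎
  where open ≡-Reasoning

*-distribʳ-+ : ∀ p q r → (q + r) * p ≋ q * p + r * p
*-distribʳ-+ p q r = ≋-trans (*-comm (q + r) p)
  (≋-trans (*-distribˡ-+ p q r) (+-cong (*-comm p q) (*-comm p r)))

*-zeroʳ : ∀ p → p * 𝟘 ≋ 𝟘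
*-zeroʳ p = *-comm p 𝟘

-‿*-distribˡ : ∀ p q → - p * q ≋ - (p * q)
-‿*-distribˡ p q = mk≋ λ d → begin
  coeffᵉ (- p * q) d                                  ≡⟨ coeff-*ˡ (- p) q d ⟩
  ⟨ q ∣ (λ e → coeffᵉ (- p) (d -ᵉ e)) ⟩               ≡⟨ pairing-congʳ q (λ e → trans (coeff-neg p (d -ᵉ e)) (sym (ℤ.-1*i≡-i _))) ⟩
  ⟨ q ∣ (λ e → ℤ.-1ℤ ℤ.* coeffᵉ p (d -ᵉ e)) ⟩         ≡⟨ trans (pairing-scaleʳ q ℤ.-1ℤ _) (ℤ.-1*i≡-i _) ⟩
  ℤ.- ⟨ q ∣ (λ e → coeffᵉ p (d -ᵉ e)) ⟩               ≡⟨ cong ℤ.-_ (coeff-*ˡ p q d) ⟨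
  ℤ.- coeffᵉ (p * q) d                                ≡⟨ coeff-neg (p * q) d ⟨
  coeffᵉ (- (p * q)) d                                ∎
  where open ≡-Reasoning

laurentRing : AlmostCommutativeRing 0ℓ 0ℓ
laurentRing = record
  { Carrier = Laurent
  ; _≈_ = _≋_
  ; _+_ = _+_
  ; _*_ = _*_
  ; -_ = -_
  ; 0# = 𝟘
  ; 1# = 𝟙
  ; isAlmostCommutativeRing = record
    { isCommutativeSemiring = record
      { isSemiring = record
        { isSemiringWithoutAnnihilatingZero = record
          { +-isCommutativeMonoid = record
            { isMonoid = record
              { isSemigroup = record
                { isMagma = record
                  { isEquivalence = record { refl = ≋-refl ; sym = ≋-sym ; trans = ≋-trans }
                  ; ∙-cong = +-cong }
                ; assoc = +-assoc }
              ; identity = (λ _ → ≋-refl) , +-identityʳ }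
            ; comm = +-comm }
          ; *-cong = *-cong
          ; *-assoc = *-assoc
          ; *-identity = *-identityˡ , *-identityʳ
          ; distrib = *-distribˡ-+ , *-distribʳ-+ }
        ; zero = (λ _ → ≋-refl) , *-zeroʳ }
      ; *-comm = *-comm }
    ; -‿cong = -‿cong
    ; -‿*-distribˡ = -‿*-distribˡ
    ; -‿+-comm = -‿+-comm } }

laurentSetoid : Setoid 0ℓ 0ℓ
laurentSetoid = AlmostCommutativeRing.setoid laurentRing

cst-+ : ∀ a b → cst (a ℤ.+ b) ≋ cst a + cst b
cst-+ a b = mk≋ λ d → trans (coeff≡pairing-δ (cst (a ℤ.+ b)) d)
  (trans (identity a b (δ d 0ᵉ)) (sym (trans (coeff-+ (cst a) (cst b) d)
    (cong₂ ℤ._+_ (coeff≡pairing-δ (cst a) d) (coeff≡pairing-δ (cst b) d)))))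
  where identity : ∀ a b x → (a ℤ.+ b) ℤ.* x ℤ.+ 0ℤ ≡ a ℤ.* x ℤ.+ 0ℤ ℤ.+ (b ℤ.* x ℤ.+ 0ℤ)
        identity = solve-∀

cst-* : ∀ a b → cst (a ℤ.* b) ≋ cst a * cst b
cst-* a b = mk≋ λ d → trans (coeff≡pairing-δ (cst (a ℤ.* b)) d)
  (trans (identity a b (δ d 0ᵉ)) (sym (coeff-* (cst a) (cst b) d)))
  where identity : ∀ a b x → a ℤ.* b ℤ.* x ℤ.+ 0ℤ ≡ a ℤ.* (b ℤ.* x ℤ.+ 0ℤ) ℤ.+ 0ℤ
        identity = solve-∀

cst-neg : ∀ a → cst (ℤ.- a) ≋ - cst a
cst-neg a = mk≋ λ d → trans (coeff≡pairing-δ (cst (ℤ.- a)) d)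
  (trans (identity a (δ d 0ᵉ)) (sym (trans (coeff-neg (cst a) d) (cong ℤ.-_ (coeff≡pairing-δ (cst a) d)))))
  where identity : ∀ a x → ℤ.- a ℤ.* x ℤ.+ 0ℤ ≡ ℤ.- (a ℤ.* x ℤ.+ 0ℤ)
        identity = solve-∀

cst-0 : cst 0ℤ ≋ 𝟘
cst-0 = mk≋ λ d → coeff≡pairing-δ (cst 0ℤ) d

cst-homomorphism : ℤ.+-*-rawRing -Raw-AlmostCommutative⟶ laurentRing
cst-homomorphism = record
  { ⟦_⟧ = cst ; +-homo = cst-+ ; *-homo = cst-* ; -‿homo = cst-neg ; 0-homo = cst-0 ; 1-homo = ≋-refl }

cst-≋? : ∀ a b → Maybe (cst a ≋ cst b)
cst-≋? a b with a ℤ.≟ b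
... | yes refl = just ≋-refl
... | no _ = nothing

-- With integer coefficients embedded by `cst`, normal forms compute and `solve` closes them by `≋-refl`.
open import Algebra.Solver.Ring ℤ.+-*-rawRing laurentRing cst-homomorphism cst-≋? using (Polynomial; solve; _:=_; _:+_; _:*_; :-_; con)

quad-cong : ∀ n {u u' v v'} → u ≋ u' → v ≋ v' → quad n u v ≋ quad n u' v'
quad-cong n u≋u' v≋v' = +-cong (+-cong (*-cong u≋u' u≋u') (*-cong (*-congʳ (nat n) u≋u') v≋v')) (*-cong v≋v' v≋v')

quad-comm : ∀ n u v → quad n u v ≋ quad n v u
quad-comm n = solve 3 (λ N u v → u :* u :+ N :* u :* v :+ v :* v := v :* v :+ N :* v :* u :+ u :* u) ≋-refl (nat n)

markovForm : ℕ → ℕ → ℕ → Laurent → Laurent → Laurent → Laurent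
markovForm n₁ n₂ n₃ a b c = a * a + b * b + c * c + nat n₁ * b * c + nat n₂ * a * c + nat n₃ * a * b

record MarkovRel (M : Laurent) (n₁ n₂ n₃ : ℕ) (a b c : Laurent) : Set where
  constructor markovRel
  field markov-≋ : M * (a * b * c) ≋ markovForm n₁ n₂ n₃ a b c
open MarkovRel public

markovRel-swap₁₂ : ∀ {M n₁ n₂ n₃ a b c} → MarkovRel M n₁ n₂ n₃ a b c → MarkovRel M n₂ n₁ n₃ b a c
markovRel-swap₁₂ {M} {n₁} {n₂} {n₃} {a} {b} {c} (markovRel rel) = markovRel $
  ≋-trans (*-congʳ M (solve 3 (λ a b c → b :* a :* c := a :* b :* c) ≋-refl a b c))
  (≋-trans rel (solve 6 (λ N₁ N₂ N₃ a b c →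
     a :* a :+ b :* b :+ c :* c :+ N₁ :* b :* c :+ N₂ :* a :* c :+ N₃ :* a :* b :=
     b :* b :+ a :* a :+ c :* c :+ N₂ :* a :* c :+ N₁ :* b :* c :+ N₃ :* b :* a) ≋-refl (nat n₁) (nat n₂) (nat n₃) a b c))

markovRel-swap₁₃ : ∀ {M n₁ n₂ n₃ a b c} → MarkovRel M n₁ n₂ n₃ a b c → MarkovRel M n₃ n₂ n₁ c b a
markovRel-swap₁₃ {M} {n₁} {n₂} {n₃} {a} {b} {c} (markovRel rel) = markovRel $
  ≋-trans (*-congʳ M (solve 3 (λ a b c → c :* b :* a := a :* b :* c) ≋-refl a b c))
  (≋-trans rel (solve 6 (λ N₁ N₂ N₃ a b c →
     a :* a :+ b :* b :+ c :* c :+ N₁ :* b :* c :+ N₂ :* a :* c :+ N₃ :* a :* b :=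
     c :* c :+ b :* b :+ a :* a :+ N₃ :* b :* a :+ N₂ :* c :* a :+ N₁ :* c :* b) ≋-refl (nat n₁) (nat n₂) (nat n₃) a b c))

markovRel-swap₂₃ : ∀ {M n₁ n₂ n₃ a b c} → MarkovRel M n₁ n₂ n₃ a b c → MarkovRel M n₁ n₃ n₂ a c b
markovRel-swap₂₃ = markovRel-swap₁₂ ∘ markovRel-swap₁₃ ∘ markovRel-swap₁₂

markovRel-cong : ∀ {M n₁ n₂ n₃ a b c a' b' c'} → a ≋ a' → b ≋ b' → c ≋ c' →
                 MarkovRel M n₁ n₂ n₃ a b c → MarkovRel M n₁ n₂ n₃ a' b' c'
markovRel-cong {M} {n₁} {n₂} {n₃} a≋a' b≋b' c≋c' (markovRel rel) = markovRel
  (≋-trans (*-congʳ M (≋-sym abc≋)) (≋-trans rel form≋))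
  where
  abc≋ = *-cong (*-cong a≋a' b≋b') c≋c'
  form≋ = +-cong (+-cong (+-cong (+-cong (+-cong (*-cong a≋a' a≋a') (*-cong b≋b' b≋b')) (*-cong c≋c' c≋c'))
                                 (*-cong (*-congʳ (nat n₁) b≋b') c≋c'))
                         (*-cong (*-congʳ (nat n₂) a≋a') c≋c'))
                 (*-cong (*-congʳ (nat n₃) a≋a') b≋b')

≋cst0⇒≋𝟘 : ∀ {p} → p ≋ cst 0ℤ → p ≋ 𝟘
≋cst0⇒≋𝟘 p≋0 = ≋-trans p≋0 cst-0

+-cong-𝟘ʳ : ∀ {x y z} → x ≋ z → y ≋ 𝟘 → x + y ≋ z
+-cong-𝟘ʳ {z = z} x≋z y≋0 = ≋-trans (+-cong x≋z y≋0) (+-identityʳ z)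

-- 2×2 matrices

infix 4 _≋ᴹ_
record _≋ᴹ_ (X Y : M2) : Set where
  constructor mk≋ᴹ
  field
    ≋₁₁ : m₁₁ X ≋ m₁₁ Y
    ≋₁₂ : m₁₂ X ≋ m₁₂ Y
    ≋₂₁ : m₂₁ X ≋ m₂₁ Y
    ≋₂₂ : m₂₂ X ≋ m₂₂ Y
open _≋ᴹ_ public

≋ᴹ-setoid : Setoid 0ℓ 0ℓ
≋ᴹ-setoid = record
  { Carrier = M2
  ; _≈_ = _≋ᴹ_
  ; isEquivalence = record
    { refl = mk≋ᴹ ≋-refl ≋-refl ≋-refl ≋-refl
    ; sym = λ (mk≋ᴹ e₁₁ e₁₂ e₂₁ e₂₂) → mk≋ᴹ (≋-sym e₁₁) (≋-sym e₁₂) (≋-sym e₂₁) (≋-sym e₂₂)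
    ; trans = λ (mk≋ᴹ e₁₁ e₁₂ e₂₁ e₂₂) (mk≋ᴹ f₁₁ f₁₂ f₂₁ f₂₂) →
        mk≋ᴹ (≋-trans e₁₁ f₁₁) (≋-trans e₁₂ f₁₂) (≋-trans e₂₁ f₂₁) (≋-trans e₂₂ f₂₂) } }

≋ᴹ⇒≈M : ∀ {X Y} → X ≋ᴹ Y → X ≈M Y
≋ᴹ⇒≈M (mk≋ᴹ e₁₁ e₁₂ e₂₁ e₂₂) = ≋⇒≈ e₁₁ , ≋⇒≈ e₁₂ , ≋⇒≈ e₂₁ , ≋⇒≈ e₂₂

≈M⇒≋ᴹ : ∀ {X Y} → X ≈M Y → X ≋ᴹ Y
≈M⇒≋ᴹ (e₁₁ , e₁₂ , e₂₁ , e₂₂) = mk≋ᴹ (≈⇒≋ e₁₁) (≈⇒≋ e₁₂) (≈⇒≋ e₂₁) (≈⇒≋ e₂₂)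

·-cong : ∀ {X X' Y Y'} → X ≋ᴹ X' → Y ≋ᴹ Y' → X · Y ≋ᴹ X' · Y'
·-cong {mat _ _ _ _} {mat _ _ _ _} {mat _ _ _ _} {mat _ _ _ _}
       (mk≋ᴹ a b c d) (mk≋ᴹ a' b' c' d') = mk≋ᴹ
  (+-cong (*-cong a a') (*-cong b c')) (+-cong (*-cong a b') (*-cong b d'))
  (+-cong (*-cong c a') (*-cong d c')) (+-cong (*-cong c b') (*-cong d d'))

I₂ : M2
I₂ = mat 𝟙 𝟘 𝟘 𝟙

-- Matrices of solver expressions, so that matrix identities can be handed to `solve`.
record Mᴾ (n : ℕ) : Set where
  constructor matᴾ
  field ₁₁ ₁₂ ₂₁ ₂₂ : Polynomial n
open Mᴾ

infixl 7 _·ᴾ_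
_·ᴾ_ : ∀ {n} → Mᴾ n → Mᴾ n → Mᴾ n
matᴾ a b c d ·ᴾ matᴾ a' b' c' d' =
  matᴾ (a :* a' :+ b :* c') (a :* b' :+ b :* d') (c :* a' :+ d :* c') (c :* b' :+ d :* d')

invᴾ : ∀ {n} → Mᴾ n → Mᴾ n
invᴾ (matᴾ a b c d) = matᴾ d (:- b) (:- c) a

detᴾ trᴾ : ∀ {n} → Mᴾ n → Polynomial n
detᴾ (matᴾ a b c d) = a :* d :+ :- (b :* c)
trᴾ (matᴾ a b c d) = a :+ d

assoc-equation : (∀ {n} → Mᴾ n → Polynomial n) → N-ary 12 (Polynomial 12) (Polynomial 12 × Polynomial 12)
assoc-equation entry a b c d a' b' c' d' a'' b'' c'' d'' = entry (X ·ᴾ Y ·ᴾ Z) := entry (X ·ᴾ (Y ·ᴾ Z))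
  where X = matᴾ a b c d; Y = matᴾ a' b' c' d'; Z = matᴾ a'' b'' c'' d''

·-assoc : ∀ X Y Z → X · Y · Z ≋ᴹ X · (Y · Z)
·-assoc (mat a b c d) (mat a' b' c' d') (mat a'' b'' c'' d'') = mk≋ᴹ
  (solve 12 (assoc-equation ₁₁) ≋-refl a b c d a' b' c' d' a'' b'' c'' d'')
  (solve 12 (assoc-equation ₁₂) ≋-refl a b c d a' b' c' d' a'' b'' c'' d'')
  (solve 12 (assoc-equation ₂₁) ≋-refl a b c d a' b' c' d' a'' b'' c'' d'')
  (solve 12 (assoc-equation ₂₂) ≋-refl a b c d a' b' c' d' a'' b'' c'' d'')

·-identityˡ : ∀ X → I₂ · X ≋ᴹ X
·-identityˡ (mat a b c d) = mk≋ᴹ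
  (+-cong-𝟘ʳ (*-identityˡ a) ≋-refl) (+-cong-𝟘ʳ (*-identityˡ b) ≋-refl)
  (*-identityˡ c) (*-identityˡ d)

·-identityʳ : ∀ X → X · I₂ ≋ᴹ X
·-identityʳ (mat a b c d) = mk≋ᴹ
  (+-cong-𝟘ʳ (*-identityʳ a) (*-zeroʳ b)) (+-cong (*-zeroʳ a) (*-identityʳ b))
  (+-cong-𝟘ʳ (*-identityʳ c) (*-zeroʳ d)) (+-cong (*-zeroʳ c) (*-identityʳ d))

·-inverseʳ : ∀ X → det X ≋ 𝟙 → X · inv X ≋ᴹ I₂
·-inverseʳ (mat a b c d) det≋1 = mk≋ᴹ
  (≋-trans (solve 4 (λ a b c d → a :* d :+ b :* (:- c) := a :* d :+ :- (b :* c)) ≋-refl a b c d) det≋1)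
  (≋cst0⇒≋𝟘 (solve 2 (λ a b → a :* (:- b) :+ b :* a := con 0ℤ) ≋-refl a b))
  (≋cst0⇒≋𝟘 (solve 2 (λ c d → c :* d :+ d :* (:- c) := con 0ℤ) ≋-refl c d))
  (≋-trans (solve 4 (λ a b c d → c :* (:- b) :+ d :* a := a :* d :+ :- (b :* c)) ≋-refl a b c d) det≋1)

·-inverseˡ : ∀ X → det X ≋ 𝟙 → inv X · X ≋ᴹ I₂
·-inverseˡ (mat a b c d) det≋1 = mk≋ᴹ
  (≋-trans (solve 4 (λ a b c d → d :* a :+ (:- b) :* c := a :* d :+ :- (b :* c)) ≋-refl a b c d) det≋1)
  (≋cst0⇒≋𝟘 (solve 2 (λ b d → d :* b :+ (:- b) :* d := con 0ℤ) ≋-refl b d))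
  (≋cst0⇒≋𝟘 (solve 2 (λ a c → (:- c) :* a :+ a :* c := con 0ℤ) ≋-refl a c))
  (≋-trans (solve 4 (λ a b c d → (:- c) :* b :+ a :* d := a :* d :+ :- (b :* c)) ≋-refl a b c d) det≋1)

open Setoid ≋ᴹ-setoid using () renaming (refl to ≋ᴹ-refl; sym to ≋ᴹ-sym; trans to ≋ᴹ-trans)

·-congˡ : ∀ {X X'} Y → X ≋ᴹ X' → X · Y ≋ᴹ X' · Y
·-congˡ Y X≋X' = ·-cong X≋X' (≋ᴹ-refl {Y})

·-congʳ : ∀ X {Y Y'} → Y ≋ᴹ Y' → X · Y ≋ᴹ X · Y'
·-congʳ X Y≋Y' = ·-cong (≋ᴹ-refl {X}) Y≋Y'

·-cancelʳ : ∀ W Z → det Z ≋ 𝟙 → W · Z · inv Z ≋ᴹ W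
·-cancelʳ W Z det≋1 = begin
  W · Z · inv Z    ≈⟨ ·-assoc W Z (inv Z) ⟩
  W · (Z · inv Z)  ≈⟨ ·-congʳ W (·-inverseʳ Z det≋1) ⟩
  W · I₂           ≈⟨ ·-identityʳ W ⟩
  W                ∎
  where open ≈-Reasoning ≋ᴹ-setoid

·-cancelʳ⁻¹ : ∀ W Z → det Z ≋ 𝟙 → W · inv Z · Z ≋ᴹ W
·-cancelʳ⁻¹ W Z det≋1 = begin
  W · inv Z · Z    ≈⟨ ·-assoc W (inv Z) Z ⟩
  W · (inv Z · Z)  ≈⟨ ·-congʳ W (·-inverseˡ Z det≋1) ⟩
  W · I₂           ≈⟨ ·-identityʳ W ⟩
  W                ∎
  where open ≈-Reasoning ≋ᴹ-setoid

·-cancelˡ : ∀ X W → det X ≋ 𝟙 → inv X · (X · W) ≋ᴹ W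
·-cancelˡ X W det≋1 = begin
  inv X · (X · W)  ≈⟨ ·-assoc (inv X) X W ⟨
  inv X · X · W    ≈⟨ ·-congˡ W (·-inverseˡ X det≋1) ⟩
  I₂ · W           ≈⟨ ·-identityˡ W ⟩
  W                ∎
  where open ≈-Reasoning ≋ᴹ-setoid

·-cancelˡ⁻¹ : ∀ X W → det X ≋ 𝟙 → X · (inv X · W) ≋ᴹ W
·-cancelˡ⁻¹ X W det≋1 = begin
  X · (inv X · W)  ≈⟨ ·-assoc X (inv X) W ⟨
  X · inv X · W    ≈⟨ ·-congˡ W (·-inverseʳ X det≋1) ⟩
  I₂ · W           ≈⟨ ·-identityˡ W ⟩
  W                ∎
  where open ≈-Reasoning ≋ᴹ-setoid

det-· : ∀ X Y → det (X · Y) ≋ det X * det Y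
det-· (mat a b c d) (mat a' b' c' d') =
  solve 8 (λ a b c d a' b' c' d' → let X = matᴾ a b c d; Y = matᴾ a' b' c' d'
            in detᴾ (X ·ᴾ Y) := detᴾ X :* detᴾ Y) ≋-refl a b c d a' b' c' d'

det-inv : ∀ X → det (inv X) ≋ det X
det-inv (mat a b c d) = solve 4 (λ a b c d → detᴾ (invᴾ (matᴾ a b c d)) := detᴾ (matᴾ a b c d)) ≋-refl a b c d

det-·-𝟙 : ∀ X Y → det X ≋ 𝟙 → det Y ≋ 𝟙 → det (X · Y) ≋ 𝟙
det-·-𝟙 X Y detX≋1 detY≋1 = ≋-trans (det-· X Y) (≋-trans (*-cong detX≋1 detY≋1) (*-identityˡ 𝟙))

det-inv-𝟙 : ∀ X → det X ≋ 𝟙 → det (inv X) ≋ 𝟙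
det-inv-𝟙 X = ≋-trans (det-inv X)

tr-cong : ∀ {X Y} → X ≋ᴹ Y → tr X ≋ tr Y
tr-cong {mat _ _ _ _} {mat _ _ _ _} (mk≋ᴹ e₁₁ _ _ e₂₂) = +-cong e₁₁ e₂₂

tr-comm : ∀ X Y → tr (X · Y) ≋ tr (Y · X)
tr-comm (mat a b c d) (mat a' b' c' d') =
  solve 8 (λ a b c d a' b' c' d' → let X = matᴾ a b c d; Y = matᴾ a' b' c' d'
            in trᴾ (X ·ᴾ Y) := trᴾ (Y ·ᴾ X)) ≋-refl a b c d a' b' c' d'

tr-conj : ∀ Y Z → det Y ≋ 𝟙 → tr (Y · Z · inv Y) ≋ tr Z
tr-conj Y Z det≋1 = ≋-trans (tr-comm (Y · Z) (inv Y)) (tr-cong (·-cancelˡ Y Z det≋1))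

tr-conj⁻¹ : ∀ Y X → det Y ≋ 𝟙 → tr (inv Y · X · Y) ≋ tr X
tr-conj⁻¹ Y X det≋1 = ≋-trans (tr-comm (inv Y · X) Y) (tr-cong (·-cancelˡ⁻¹ Y X det≋1))

right-quotient : ∀ W Z {T} → W · Z ≋ᴹ T → det Z ≋ 𝟙 → W ≋ᴹ T · inv Z
right-quotient W Z W·Z≋T det≋1 = ≋ᴹ-trans (≋ᴹ-sym (·-cancelʳ W Z det≋1)) (·-congˡ (inv Z) W·Z≋T)

left-quotient : ∀ X W {T} → X · W ≋ᴹ T → det X ≋ 𝟙 → W ≋ᴹ inv X · T
left-quotient X W X·W≋T det≋1 = ≋ᴹ-trans (≋ᴹ-sym (·-cancelˡ X W det≋1)) (·-congʳ (inv X) X·W≋T)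

conj-product : ∀ X Y Z → det Y ≋ 𝟙 → X · (Y · Z · inv Y) · Y ≋ᴹ X · Y · Z
conj-product X Y Z det≋1 = begin
  X · (Y · Z · inv Y) · Y    ≈⟨ ·-assoc X (Y · Z · inv Y) Y ⟩
  X · (Y · Z · inv Y · Y)    ≈⟨ ·-congʳ X (·-cancelʳ⁻¹ (Y · Z) Y det≋1) ⟩
  X · (Y · Z)                ≈⟨ ·-assoc X Y Z ⟨
  X · Y · Z                  ∎
  where open ≈-Reasoning ≋ᴹ-setoid

conj⁻¹-product : ∀ X Y Z → det Y ≋ 𝟙 → Y · (inv Y · X · Y) · Z ≋ᴹ X · Y · Z
conj⁻¹-product X Y Z det≋1 = ·-congˡ Z (begin
  Y · (inv Y · X · Y)        ≈⟨ ·-assoc Y (inv Y · X) Y ⟨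
  Y · (inv Y · X) · Y        ≈⟨ ·-congˡ Y (·-cancelˡ⁻¹ Y X det≋1) ⟩
  X · Y                      ∎)
  where open ≈-Reasoning ≋ᴹ-setoid

m₁₂-T·inv : ∀ k Z → m₁₂ (Tmat k · inv Z) ≋ m₁₂ Z
m₁₂-T·inv k (mat e c f g) = +-cong-𝟘ʳ (solve 1 (λ c → (:- con 1ℤ) :* (:- c) := c) ≋-refl c) ≋-refl

m₁₂-inv·T : ∀ k X → m₁₂ (inv X · Tmat k) ≋ m₁₂ X
m₁₂-inv·T k (mat p a q r) =
  ≋-trans (+-cong (*-zeroʳ r) ≋-refl) (solve 1 (λ a → (:- a) :* (:- con 1ℤ) := a) ≋-refl a)

tr-T·inv : ∀ k Z → tr (Tmat k · inv Z) ≋ - tr Z + - (𝓜 k * m₁₂ Z)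
tr-T·inv k (mat e c f g) = ≋-trans (+-cong (+-identityʳ ((- 𝟙) * g)) ≋-refl)
  (solve 4 (λ M e c g → (:- con 1ℤ) :* g :+ (M :* (:- c) :+ (:- con 1ℤ) :* e) := :- (e :+ g) :+ :- (M :* c))
    ≋-refl (𝓜 k) e c g)

quadratic-form : ∀ {t δ} n A B → t ≋ - nat n → δ ≋ 𝟙 → A * A + - (t * A * B) + δ * (B * B) ≋ quad n A B
quadratic-form n A B t≋-n δ≋1 =
  ≋-trans (+-cong (+-cong ≋-refl (-‿cong (*-congˡ B (*-congˡ A t≋-n)))) (*-congˡ (B * B) δ≋1))
          (solve 3 (λ N A B → A :* A :+ :- ((:- N) :* A :* B) :+ con 1ℤ :* (B :* B) := A :* A :+ N :* A :* B :+ B :* B)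
                   ≋-refl (nat n) A B)

conj-entry : ∀ P Q → m₁₂ (P · Q · inv P) * m₁₂ Q ≋
             m₁₂ (P · Q) * m₁₂ (P · Q) + - (tr Q * m₁₂ (P · Q) * m₁₂ P) + det Q * (m₁₂ P * m₁₂ P)
conj-entry (mat u b v w) (mat e c f g) =
  solve 8 (λ u b v w e c f g → let P = matᴾ u b v w; Q = matᴾ e c f g; A = ₁₂ (P ·ᴾ Q)
            in ₁₂ (P ·ᴾ Q ·ᴾ invᴾ P) :* c := A :* A :+ :- (trᴾ Q :* A :* b) :+ detᴾ Q :* (b :* b))
    ≋-refl u b v w e c f g

conj⁻¹-entry : ∀ P Q → m₁₂ (inv P · Q · P) * m₁₂ Q ≋
               m₁₂ (Q · P) * m₁₂ (Q · P) + - (tr Q * m₁₂ (Q · P) * m₁₂ P) + det Q * (m₁₂ P * m₁₂ P)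
conj⁻¹-entry (mat u b v w) (mat p a q r) =
  solve 8 (λ u b v w p a q r → let P = matᴾ u b v w; Q = matᴾ p a q r; A = ₁₂ (Q ·ᴾ P)
            in ₁₂ (invᴾ P ·ᴾ Q ·ᴾ P) :* a := A :* A :+ :- (trᴾ Q :* A :* b) :+ detᴾ Q :* (b :* b))
    ≋-refl u b v w p a q r

fricke : ∀ X Y → - (m₁₂ X * m₁₂ Y * tr (X · Y)) ≋
         m₁₂ X * m₁₂ X * det Y + m₁₂ Y * m₁₂ Y * det X + m₁₂ (X · Y) * m₁₂ (X · Y)
         + - (tr X * m₁₂ Y * m₁₂ (X · Y)) + - (tr Y * m₁₂ X * m₁₂ (X · Y))
fricke (mat p a q r) (mat u b v w) =
  solve 8 (λ p a q r u b v w → let X = matᴾ p a q r; Y = matᴾ u b v w; C = ₁₂ (X ·ᴾ Y)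
            in :- (a :* b :* trᴾ (X ·ᴾ Y)) := a :* a :* detᴾ Y :+ b :* b :* detᴾ X :+ C :* C
                                                :+ :- (trᴾ X :* b :* C) :+ :- (trᴾ Y :* a :* C))
    ≋-refl p a q r u b v w

record SL₂Tr (n : ℕ) (X : M2) : Set where
  field
    det≋𝟙 : det X ≋ 𝟙
    tr≋-n : tr X ≋ - nat n
open SL₂Tr public

fricke-SL₂Tr : ∀ {nX nY X Y} → SL₂Tr nX X → SL₂Tr nY Y →
               - (m₁₂ X * m₁₂ Y * tr (X · Y)) ≋ m₁₂ X * m₁₂ X + m₁₂ Y * m₁₂ Y + m₁₂ (X · Y) * m₁₂ (X · Y)
                                                 + nat nX * m₁₂ Y * m₁₂ (X · Y) + nat nY * m₁₂ X * m₁₂ (X · Y)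
fricke-SL₂Tr {nX} {nY} {X} {Y} sX sY = ≋-trans (fricke X Y) (≋-trans
  (+-cong (+-cong (+-cong (+-cong (*-congʳ (a * a) (det≋𝟙 sY)) (*-congʳ (b * b) (det≋𝟙 sX))) ≋-refl)
                  (-‿cong (*-congˡ C (*-congˡ b (tr≋-n sX)))))
          (-‿cong (*-congˡ C (*-congˡ a (tr≋-n sY)))))
  (solve 5 (λ NX NY a b C → a :* a :* con 1ℤ :+ b :* b :* con 1ℤ :+ C :* C
                            :+ :- ((:- NX) :* b :* C) :+ :- ((:- NY) :* a :* C)
                            := a :* a :+ b :* b :+ C :* C :+ NX :* b :* C :+ NY :* a :* C)
    ≋-refl (nat nX) (nat nY) a b C))
  where a = m₁₂ X; b = m₁₂ Y; C = m₁₂ (X · Y)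

module CMMRelations {k nX nY nZ X Y Z} (sX : SL₂Tr nX X) (sY : SL₂Tr nY Y) (sZ : SL₂Tr nZ Z)
                    (XYZ≋T : X · Y · Z ≋ᴹ Tmat k) where

  m₁₂-XY : m₁₂ (X · Y) ≋ m₁₂ Z
  m₁₂-XY = ≋-trans (≋₁₂ (right-quotient (X · Y) Z XYZ≋T (det≋𝟙 sZ))) (m₁₂-T·inv k Z)

  m₁₂-YZ : m₁₂ (Y · Z) ≋ m₁₂ X
  m₁₂-YZ = ≋-trans (≋₁₂ (left-quotient X (Y · Z) (≋ᴹ-trans (≋ᴹ-sym (·-assoc X Y Z)) XYZ≋T) (det≋𝟙 sX)))
                   (m₁₂-inv·T k X)

  tr-XY : tr (X · Y) ≋ - tr Z + - (𝓜 k * m₁₂ Z)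
  tr-XY = ≋-trans (tr-cong (right-quotient (X · Y) Z XYZ≋T (det≋𝟙 sZ))) (tr-T·inv k Z)

  conj-exchange : m₁₂ (Y · Z · inv Y) * m₁₂ Z ≋ quad nZ (m₁₂ X) (m₁₂ Y)
  conj-exchange = ≋-trans (conj-entry Y Z)
    (≋-trans (quadratic-form nZ _ _ (tr≋-n sZ) (det≋𝟙 sZ)) (quad-cong nZ m₁₂-YZ ≋-refl))

  conj⁻¹-exchange : m₁₂ (inv Y · X · Y) * m₁₂ X ≋ quad nX (m₁₂ Y) (m₁₂ Z)
  conj⁻¹-exchange = ≋-trans (conj⁻¹-entry Y X)
    (≋-trans (quadratic-form nX _ _ (tr≋-n sX) (det≋𝟙 sX))
    (≋-trans (quad-cong nX m₁₂-XY ≋-refl) (quad-comm nX (m₁₂ Z) (m₁₂ Y))))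

  conj-SL₂Tr : SL₂Tr nZ (Y · Z · inv Y)
  conj-SL₂Tr = record
    { det≋𝟙 = det-·-𝟙 (Y · Z) (inv Y) (det-·-𝟙 Y Z (det≋𝟙 sY) (det≋𝟙 sZ)) (det-inv-𝟙 Y (det≋𝟙 sY))
    ; tr≋-n = ≋-trans (tr-conj Y Z (det≋𝟙 sY)) (tr≋-n sZ) }

  conj⁻¹-SL₂Tr : SL₂Tr nX (inv Y · X · Y)
  conj⁻¹-SL₂Tr = record
    { det≋𝟙 = det-·-𝟙 (inv Y · X) Y (det-·-𝟙 (inv Y) X (det-inv-𝟙 Y (det≋𝟙 sY)) (det≋𝟙 sX)) (det≋𝟙 sY)
    ; tr≋-n = ≋-trans (tr-conj⁻¹ Y X (det≋𝟙 sY)) (tr≋-n sX) }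

  conj-triple-product : X · (Y · Z · inv Y) · Y ≋ᴹ Tmat k
  conj-triple-product = ≋ᴹ-trans (conj-product X Y Z (det≋𝟙 sY)) XYZ≋T

  conj⁻¹-triple-product : Y · (inv Y · X · Y) · Z ≋ᴹ Tmat k
  conj⁻¹-triple-product = ≋ᴹ-trans (conj⁻¹-product X Y Z (det≋𝟙 sY)) XYZ≋T

  -- tr (X Y) = −tr Z − 𝓜 c turns the Fricke identity into the Markov relation.
  markovRel-cmm : MarkovRel (𝓜 k) nX nY nZ (m₁₂ X) (m₁₂ Y) (m₁₂ Z)
  markovRel-cmm = markovRel (begin
    𝓜 k * (a * b * c)
      ≈⟨ solve 5 (λ M N a b c → M :* (a :* b :* c) := :- (a :* b :* (:- (:- N) :+ :- (M :* c))) :+ N :* a :* b)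
               ≋-refl (𝓜 k) (nat nZ) a b c ⟩
    - (a * b * (- (- nat nZ) + - (𝓜 k * c))) + nat nZ * a * b
      ≈⟨ +-cong (-‿cong (*-congʳ (a * b) (≋-trans (+-cong (-‿cong (≋-sym (tr≋-n sZ))) ≋-refl) (≋-sym tr-XY)))) ≋-refl ⟩
    - (a * b * tr (X · Y)) + nat nZ * a * b
      ≈⟨ +-cong (fricke-SL₂Tr sX sY) ≋-refl ⟩
    a * a + b * b + C * C + nat nX * b * C + nat nY * a * C + nat nZ * a * b
      ≈⟨ +-cong (+-cong (+-cong (+-cong (≋-refl {a * a + b * b}) (*-cong m₁₂-XY m₁₂-XY))
                                (*-congʳ (nat nX * b) m₁₂-XY))
                        (*-congʳ (nat nY * a) m₁₂-XY))
                (≋-refl {nat nZ * a * b}) ⟩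
    markovForm nX nY nZ a b c ∎)
    where
    open ≈-Reasoning laurentSetoid
    a = m₁₂ X; b = m₁₂ Y; c = m₁₂ Z; C = m₁₂ (X · Y)

-- Leading terms for the lexicographic order

infix 4 _<ᵉ_ _≤ᵉ_
data _<ᵉ_ : Exponent → Exponent → Set where
  <₁ : ∀ {a b c a' b' c'} → a ℤ.< a' → (a , b , c) <ᵉ (a' , b' , c')
  <₂ : ∀ {a b c b' c'} → b ℤ.< b' → (a , b , c) <ᵉ (a , b' , c')
  <₃ : ∀ {a b c c'} → c ℤ.< c' → (a , b , c) <ᵉ (a , b , c')

_≤ᵉ_ : Exponent → Exponent → Set
d ≤ᵉ e = d <ᵉ e ⊎ d ≡ e

<ᵉ-irrefl : ∀ {d} → ¬ d <ᵉ d
<ᵉ-irrefl (<₁ a<a) = ℤ.<-irrefl refl a<a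
<ᵉ-irrefl (<₂ b<b) = ℤ.<-irrefl refl b<b
<ᵉ-irrefl (<₃ c<c) = ℤ.<-irrefl refl c<c

<ᵉ⇒≢ : ∀ {d e} → d <ᵉ e → d ≢ e
<ᵉ⇒≢ d<e refl = <ᵉ-irrefl d<e

<ᵉ-trans : ∀ {d e f} → d <ᵉ e → e <ᵉ f → d <ᵉ f
<ᵉ-trans (<₁ p) (<₁ q) = <₁ (ℤ.<-trans p q)
<ᵉ-trans (<₁ p) (<₂ _) = <₁ p
<ᵉ-trans (<₁ p) (<₃ _) = <₁ p
<ᵉ-trans (<₂ _) (<₁ q) = <₁ q
<ᵉ-trans (<₂ p) (<₂ q) = <₂ (ℤ.<-trans p q)
<ᵉ-trans (<₂ p) (<₃ _) = <₂ p
<ᵉ-trans (<₃ _) (<₁ q) = <₁ q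
<ᵉ-trans (<₃ _) (<₂ q) = <₂ q
<ᵉ-trans (<₃ p) (<₃ q) = <₃ (ℤ.<-trans p q)

<ᵉ-asym : ∀ {d e} → d <ᵉ e → ¬ e <ᵉ d
<ᵉ-asym d<e e<d = <ᵉ-irrefl (<ᵉ-trans d<e e<d)

≤-<ᵉ-trans : ∀ {d e f} → d ≤ᵉ e → e <ᵉ f → d <ᵉ f
≤-<ᵉ-trans (inj₁ d<e) e<f = <ᵉ-trans d<e e<f
≤-<ᵉ-trans (inj₂ refl) e<f = e<f

<ᵉ-cmp : Trichotomous _≡_ _<ᵉ_
<ᵉ-cmp (a , b , c) (a' , b' , c') with ℤ.<-cmp a a'
... | tri< p _ _ = tri< (<₁ p) (λ { refl → ℤ.<-irrefl refl p }) (<ᵉ-asym (<₁ p))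
... | tri> _ _ p = tri> (<ᵉ-asym (<₁ p)) (λ { refl → ℤ.<-irrefl refl p }) (<₁ p)
... | tri≈ _ refl _ with ℤ.<-cmp b b'
...   | tri< p _ _ = tri< (<₂ p) (λ { refl → ℤ.<-irrefl refl p }) (<ᵉ-asym (<₂ p))
...   | tri> _ _ p = tri> (<ᵉ-asym (<₂ p)) (λ { refl → ℤ.<-irrefl refl p }) (<₂ p)
...   | tri≈ _ refl _ with ℤ.<-cmp c c'
...     | tri< p _ _ = tri< (<₃ p) (λ { refl → ℤ.<-irrefl refl p }) (<ᵉ-asym (<₃ p))
...     | tri> _ _ p = tri> (<ᵉ-asym (<₃ p)) (λ { refl → ℤ.<-irrefl refl p }) (<₃ p)
...     | tri≈ _ refl _ = tri≈ <ᵉ-irrefl refl <ᵉ-irrefl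

≮ᵉ⇒≥ᵉ : ∀ {d e} → ¬ e <ᵉ d → d ≤ᵉ e
≮ᵉ⇒≥ᵉ {d} {e} e≮d with <ᵉ-cmp d e
... | tri< d<e _ _ = inj₁ d<e
... | tri≈ _ d≡e _ = inj₂ d≡e
... | tri> _ _ e<d = contradiction e<d e≮d

+ᵉ-monoˡ-< : ∀ {d e} f → d <ᵉ e → d +ᵉ f <ᵉ e +ᵉ f
+ᵉ-monoˡ-< (_ , _ , _) (<₁ p) = <₁ (ℤ.+-monoˡ-< _ p)
+ᵉ-monoˡ-< (_ , _ , _) (<₂ p) = <₂ (ℤ.+-monoˡ-< _ p)
+ᵉ-monoˡ-< (_ , _ , _) (<₃ p) = <₃ (ℤ.+-monoˡ-< _ p)

+ᵉ-monoʳ-< : ∀ f {d e} → d <ᵉ e → f +ᵉ d <ᵉ f +ᵉ e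
+ᵉ-monoʳ-< f {d} {e} d<e = subst₂ _<ᵉ_ (+ᵉ-comm d f) (+ᵉ-comm e f) (+ᵉ-monoˡ-< f d<e)

+ᵉ-monoˡ-≤ : ∀ {d e} f → d ≤ᵉ e → d +ᵉ f ≤ᵉ e +ᵉ f
+ᵉ-monoˡ-≤ f (inj₁ d<e) = inj₁ (+ᵉ-monoˡ-< f d<e)
+ᵉ-monoˡ-≤ f (inj₂ refl) = inj₂ refl

+ᵉ-cancelˡ-< : ∀ {d e} f → d +ᵉ f <ᵉ e +ᵉ f → d <ᵉ e
+ᵉ-cancelˡ-< {d} {e} f lt = subst₂ _<ᵉ_ (+ᵉ--ᵉ-cancelʳ d f) (+ᵉ--ᵉ-cancelʳ e f) (+ᵉ-monoˡ-< (0ᵉ -ᵉ f) lt)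

<ᵉ-shift : ∀ {e A B d} → e ≤ᵉ A → A +ᵉ B <ᵉ d → B <ᵉ d -ᵉ e
<ᵉ-shift {e} {A} {B} {d} e≤A A+B<d = +ᵉ-cancelˡ-< e
  (subst₂ _<ᵉ_ (+ᵉ-comm e B) (sym (-ᵉ+ᵉ-cancel d e)) (≤-<ᵉ-trans (+ᵉ-monoˡ-≤ B e≤A) A+B<d))

<ᵉ-shift-strict : ∀ {e A} B → e <ᵉ A → B <ᵉ A +ᵉ B -ᵉ e
<ᵉ-shift-strict {e} {A} B e<A = +ᵉ-cancelˡ-< e
  (subst₂ _<ᵉ_ (+ᵉ-comm e B) (sym (-ᵉ+ᵉ-cancel (A +ᵉ B) e)) (+ᵉ-monoˡ-< B e<A))

remove : Exponent → Laurent → Laurent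
remove e [] = []
remove e (t ∷ p) = if exponent t ==ᵉ e then remove e p else t ∷ remove e p

pairing-remove : ∀ p e g → ⟨ p ∣ g ⟩ ≡ coeffᵉ p e ℤ.* g e ℤ.+ ⟨ remove e p ∣ g ⟩
pairing-remove [] e g = sym (ℤ.+-identityʳ (0ℤ ℤ.* g e))
pairing-remove (t ∷ p) e g with exponent t ==ᵉ e in eq
... | true = trans (cong₂ ℤ._+_ (cong (λ d → cf t ℤ.* g d) (==ᵉ⇒≡ eq)) (pairing-remove p e g))
                 (identity (cf t) (g e) (coeffᵉ p e) ⟨ remove e p ∣ g ⟩)
  where identity : ∀ c x y r → c ℤ.* x ℤ.+ (y ℤ.* x ℤ.+ r) ≡ (c ℤ.+ y) ℤ.* x ℤ.+ r
        identity = solve-∀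
... | false rewrite pairing-remove p e g =
  identity (cf t ℤ.* g (exponent t)) (coeffᵉ p e ℤ.* g e) ⟨ remove e p ∣ g ⟩
  where identity : ∀ a b r → a ℤ.+ (b ℤ.+ r) ≡ b ℤ.+ (a ℤ.+ r)
        identity = solve-∀

coeff-remove-≢ : ∀ p {e d} → e ≢ d → coeffᵉ (remove e p) d ≡ coeffᵉ p d
coeff-remove-≢ p {e} {d} e≢d = sym (begin
  coeffᵉ p d
    ≡⟨ trans (coeff≡pairing-δ p d) (pairing-remove p e (δ d)) ⟩
  coeffᵉ p e ℤ.* δ d e ℤ.+ ⟨ remove e p ∣ δ d ⟩
    ≡⟨ cong (λ w → coeffᵉ p e ℤ.* w ℤ.+ ⟨ remove e p ∣ δ d ⟩) (δ-off e≢d) ⟩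
  coeffᵉ p e ℤ.* 0ℤ ℤ.+ ⟨ remove e p ∣ δ d ⟩
    ≡⟨ trans (cong (ℤ._+ ⟨ remove e p ∣ δ d ⟩) (ℤ.*-zeroʳ (coeffᵉ p e))) (ℤ.+-identityˡ _) ⟩
  ⟨ remove e p ∣ δ d ⟩
    ≡⟨ coeff≡pairing-δ (remove e p) d ⟨
  coeffᵉ (remove e p) d ∎)
  where open ≡-Reasoning

coeff-remove-≡ : ∀ p e → coeffᵉ (remove e p) e ≡ 0ℤ
coeff-remove-≡ p e = x≡x+y⇒y≡0 (begin
  coeffᵉ p e
    ≡⟨ trans (coeff≡pairing-δ p e) (pairing-remove p e (δ e)) ⟩
  coeffᵉ p e ℤ.* δ e e ℤ.+ ⟨ remove e p ∣ δ e ⟩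
    ≡⟨ cong₂ ℤ._+_ (trans (cong (coeffᵉ p e ℤ.*_) (δ-diag e)) (ℤ.*-identityʳ (coeffᵉ p e)))
                   (sym (coeff≡pairing-δ (remove e p) e)) ⟩
  coeffᵉ p e ℤ.+ coeffᵉ (remove e p) e ∎)
  where
  open ≡-Reasoning
  x≡x+y⇒y≡0 : ∀ {x y} → x ≡ x ℤ.+ y → y ≡ 0ℤ
  x≡x+y⇒y≡0 {x} {y} eq = trans (sym (cancel x y)) (trans (cong (ℤ._- x) (sym eq)) (ℤ.+-inverseʳ x))
    where cancel : ∀ x y → x ℤ.+ y ℤ.- x ≡ y
          cancel = solve-∀

length-remove : ∀ e p → length (remove e p) ℕ.≤ length p
length-remove e [] = z≤n
length-remove e (t ∷ p) with exponent t ==ᵉ e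
... | true  = ℕ.m≤n⇒m≤1+n (length-remove e p)
... | false = s≤s (length-remove e p)

-- A list may repeat an exponent, so the induction removes one exponent at a time.
pairing-support : ∀ p {g h} → (∀ e → coeffᵉ p e ≢ 0ℤ → g e ≡ h e) → ⟨ p ∣ g ⟩ ≡ ⟨ p ∣ h ⟩
pairing-support p = go (length p) p ℕ.≤-refl
  where
  go : ∀ n p {g h} → length p ℕ.≤ n → (∀ e → coeffᵉ p e ≢ 0ℤ → g e ≡ h e) → ⟨ p ∣ g ⟩ ≡ ⟨ p ∣ h ⟩
  go n [] _ _ = refl
  go (suc n) (t ∷ p) {g} {h} (s≤s |p|≤n) g≗h =
    trans (pairing-remove (t ∷ p) e g) (trans (cong₂ ℤ._+_ at-e elsewhere) (sym (pairing-remove (t ∷ p) e h)))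
    where
    e = exponent t
    at-e : coeffᵉ (t ∷ p) e ℤ.* g e ≡ coeffᵉ (t ∷ p) e ℤ.* h e
    at-e with coeffᵉ (t ∷ p) e ℤ.≟ 0ℤ
    ... | yes c≡0 = trans (cong (ℤ._* g e) c≡0) (sym (cong (ℤ._* h e) c≡0))
    ... | no c≢0 = cong (coeffᵉ (t ∷ p) e ℤ.*_) (g≗h e c≢0)
    shorter : length (remove e (t ∷ p)) ℕ.≤ n
    shorter rewrite ==ᵉ-refl e = ℕ.≤-trans (length-remove e p) |p|≤n
    elsewhere : ⟨ remove e (t ∷ p) ∣ g ⟩ ≡ ⟨ remove e (t ∷ p) ∣ h ⟩
    elsewhere = go n (remove e (t ∷ p)) shorter λ d c≢0 → g≗h d λ c≡0 → c≢0 (vanishes d c≡0)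
      where
      vanishes : ∀ d → coeffᵉ (t ∷ p) d ≡ 0ℤ → coeffᵉ (remove e (t ∷ p)) d ≡ 0ℤ
      vanishes d c≡0 with <ᵉ-cmp e d
      ... | tri≈ _ refl _ = coeff-remove-≡ (t ∷ p) e
      ... | tri< _ e≢d _  = trans (coeff-remove-≢ (t ∷ p) e≢d) c≡0
      ... | tri> _ e≢d _  = trans (coeff-remove-≢ (t ∷ p) e≢d) c≡0

record Bounded (p : Laurent) (A : Exponent) : Set where
  constructor mkBounded
  field vanishes-above : ∀ e → A <ᵉ e → coeffᵉ p e ≡ 0ℤ
open Bounded public

record Leading (p : Laurent) (A : Exponent) : Set where
  constructor mkLeading
  field
    bounded : Bounded p A
    leading≢0 : coeffᵉ p A ≢ 0ℤ
open Leading public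

support-≤ : ∀ {p A e} → Bounded p A → coeffᵉ p e ≢ 0ℤ → e ≤ᵉ A
support-≤ {p} {A} {e} p≤A c≢0 = ≮ᵉ⇒≥ᵉ (λ A<e → c≢0 (vanishes-above p≤A e A<e))

*-bounded : ∀ {p q A B} → Bounded p A → Bounded q B → Bounded (p * q) (A +ᵉ B)
*-bounded {p} {q} p≤A q≤B = mkBounded λ d A+B<d → begin
  coeffᵉ (p * q) d
    ≡⟨ coeff-*ʳ p q d ⟩
  ⟨ p ∣ (λ e → coeffᵉ q (d -ᵉ e)) ⟩
    ≡⟨ pairing-support p (λ e c≢0 → vanishes-above q≤B _ (<ᵉ-shift (support-≤ p≤A c≢0) A+B<d)) ⟩
  ⟨ p ∣ (λ _ → 0ℤ) ⟩
    ≡⟨ pairing-0ʳ p ⟩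
  0ℤ ∎
  where open ≡-Reasoning

coeff-*-top : ∀ {p q A B} → Bounded p A → Bounded q B → coeffᵉ (p * q) (A +ᵉ B) ≡ coeffᵉ p A ℤ.* coeffᵉ q B
coeff-*-top {p} {q} {A} {B} p≤A q≤B = begin
  coeffᵉ (p * q) (A +ᵉ B)                    ≡⟨ coeff-*ʳ p q (A +ᵉ B) ⟩
  ⟨ p ∣ (λ e → coeffᵉ q (A +ᵉ B -ᵉ e)) ⟩     ≡⟨ pairing-support p only-A ⟩
  ⟨ p ∣ (λ e → coeffᵉ q B ℤ.* δ A e) ⟩       ≡⟨ pairing-scaleʳ p (coeffᵉ q B) (δ A) ⟩
  coeffᵉ q B ℤ.* ⟨ p ∣ δ A ⟩                 ≡⟨ cong (coeffᵉ q B ℤ.*_) (coeff≡pairing-δ p A) ⟨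
  coeffᵉ q B ℤ.* coeffᵉ p A                  ≡⟨ ℤ.*-comm (coeffᵉ q B) (coeffᵉ p A) ⟩
  coeffᵉ p A ℤ.* coeffᵉ q B                  ∎
  where
  open ≡-Reasoning
  only-A : ∀ e → coeffᵉ p e ≢ 0ℤ → coeffᵉ q (A +ᵉ B -ᵉ e) ≡ coeffᵉ q B ℤ.* δ A e
  only-A e c≢0 with support-≤ p≤A c≢0
  ... | inj₂ refl = trans (cong (coeffᵉ q) (+ᵉ--ᵉ-cancel A B))
                          (trans (sym (ℤ.*-identityʳ (coeffᵉ q B))) (cong (coeffᵉ q B ℤ.*_) (sym (δ-diag A))))
  ... | inj₁ e<A = trans (vanishes-above q≤B _ (<ᵉ-shift-strict B e<A))
                         (trans (sym (ℤ.*-zeroʳ (coeffᵉ q B))) (cong (coeffᵉ q B ℤ.*_) (sym (δ-off (<ᵉ⇒≢ e<A)))))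

+-bounded : ∀ {p q A} → Bounded p A → Bounded q A → Bounded (p + q) A
+-bounded {p} {q} p≤A q≤A = mkBounded λ e A<e →
  trans (coeff-+ p q e) (cong₂ ℤ._+_ (vanishes-above p≤A e A<e) (vanishes-above q≤A e A<e))

bounded-mono : ∀ {p A B} → Bounded p A → A ≤ᵉ B → Bounded p B
bounded-mono p≤A A≤B = mkBounded λ e B<e → vanishes-above p≤A e (≤-<ᵉ-trans A≤B B<e)

bounded-≋ : ∀ {p q A} → p ≋ q → Bounded p A → Bounded q A
bounded-≋ (mk≋ eq) p≤A = mkBounded λ e A<e → trans (sym (eq e)) (vanishes-above p≤A e A<e)

cst-bounded : ∀ z → Bounded (cst z) 0ᵉ
cst-bounded z = mkBounded λ e 0<e → trans (coeff≡pairing-δ (cst z) e)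
  (trans (cong (λ w → z ℤ.* w ℤ.+ 0ℤ) (δ-off (<ᵉ⇒≢ 0<e))) (cong (ℤ._+ 0ℤ) (ℤ.*-zeroʳ z)))

leading-≋ : ∀ {p q A} → p ≋ q → Leading p A → Leading q A
leading-≋ p≋q (mkLeading p≤A c≢0) = mkLeading (bounded-≋ p≋q p≤A) (λ c≡0 → c≢0 (trans (coeff-≡ p≋q _) c≡0))

*-leading : ∀ {p q A B} → Leading p A → Leading q B → Leading (p * q) (A +ᵉ B)
*-leading (mkLeading p≤A p≢0) (mkLeading q≤B q≢0) = mkLeading (*-bounded p≤A q≤B)
  λ c≡0 → [ p≢0 , q≢0 ]′ (ℤ.i*j≡0⇒i≡0∨j≡0 _ (trans (sym (coeff-*-top p≤A q≤B)) c≡0))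

leading-unique : ∀ {p A B} → Leading p A → Leading p B → A ≡ B
leading-unique {p} {A} {B} (mkLeading p≤A pA≢0) (mkLeading p≤B pB≢0) with <ᵉ-cmp A B
... | tri< A<B _ _ = contradiction (vanishes-above p≤A B A<B) pB≢0
... | tri≈ _ A≡B _ = A≡B
... | tri> _ _ B<A = contradiction (vanishes-above p≤B A B<A) pA≢0

Listed : Exponent → Laurent → Set
Listed d L = Any (λ t → exponent t ≡ d) L

support-listed : ∀ p {d} → coeffᵉ p d ≢ 0ℤ → Listed d p
support-listed [] c≢0 = contradiction refl c≢0
support-listed (t ∷ p) {d} c≢0 with exponent t ==ᵉ d in eq
... | true  = here (==ᵉ⇒≡ eq)
... | false = there (support-listed p c≢0)

LargestNonzero : Laurent → Laurent → Set
LargestNonzero p L = ∃ λ A → coeffᵉ p A ≢ 0ℤ × (∀ d → Listed d L → coeffᵉ p d ≢ 0ℤ → d ≤ᵉ A)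

largest-nonzero : ∀ p L → (∀ d → Listed d L → coeffᵉ p d ≡ 0ℤ) ⊎ LargestNonzero p L
largest-nonzero p [] = inj₁ (λ d ())
largest-nonzero p (t ∷ L) with largest-nonzero p L | coeffᵉ p (exponent t) ℤ.≟ 0ℤ
... | inj₁ zero-on-L | yes t≡0 = inj₁ λ { d (here refl) → t≡0 ; d (there d∈L) → zero-on-L d d∈L }
... | inj₁ zero-on-L | no t≢0 = inj₂ (exponent t , t≢0 ,
      λ { d (here refl) _ → inj₂ refl ; d (there d∈L) d≢0 → contradiction (zero-on-L d d∈L) d≢0 })
... | inj₂ (A , A≢0 , ≤A) | yes t≡0 = inj₂ (A , A≢0 ,
      λ { d (here refl) d≢0 → contradiction t≡0 d≢0 ; d (there d∈L) d≢0 → ≤A d d∈L d≢0 })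
... | inj₂ (A , A≢0 , ≤A) | no t≢0 with <ᵉ-cmp (exponent t) A
...   | tri< t<A _ _ = inj₂ (A , A≢0 , λ { d (here refl) _ → inj₁ t<A ; d (there d∈L) d≢0 → ≤A d d∈L d≢0 })
...   | tri≈ _ t≡A _ = inj₂ (A , A≢0 , λ { d (here refl) _ → inj₂ t≡A ; d (there d∈L) d≢0 → ≤A d d∈L d≢0 })
...   | tri> _ _ A<t = inj₂ (exponent t , t≢0 ,
        λ { d (here refl) _ → inj₂ refl ; d (there d∈L) d≢0 → inj₁ (≤-<ᵉ-trans (≤A d d∈L d≢0) A<t) })

zero-or-leading : ∀ p → p ≋ 𝟘 ⊎ ∃ (Leading p)
zero-or-leading p with largest-nonzero p p
... | inj₁ zero-on-p = inj₁ (mk≋ λ d → decidable-stable (coeffᵉ p d ℤ.≟ 0ℤ)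
                                        (λ c≢0 → c≢0 (zero-on-p d (support-listed p c≢0))))
... | inj₂ (A , A≢0 , ≤A) = inj₂ (A , mkLeading (mkBounded above-A) A≢0)
  where
  above-A : ∀ e → A <ᵉ e → coeffᵉ p e ≡ 0ℤ
  above-A e A<e = decidable-stable (coeffᵉ p e ℤ.≟ 0ℤ)
    (λ e≢0 → <ᵉ-irrefl (≤-<ᵉ-trans (≤A e (support-listed p e≢0) e≢0) A<e))

*-cancelˡ : ∀ {a A x y} → Leading a A → a * x ≋ a * y → x ≋ y
*-cancelˡ {a} {A} {x} {y} a↑A ax≋ay with zero-or-leading (x + - y)
... | inj₁ x-y≋0 = ≋-trans (solve 2 (λ x y → x := (x :+ :- y) :+ y) ≋-refl x y) (+-cong x-y≋0 (≋-refl {y}))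
... | inj₂ (B , x-y↑B) = contradiction (coeff-≡ a[x-y]≋0 (A +ᵉ B)) (leading≢0 (*-leading a↑A x-y↑B))
  where
  a[x-y]≋0 : a * (x + - y) ≋ 𝟘
  a[x-y]≋0 = ≋-trans (solve 3 (λ a x y → a :* (x :+ :- y) := a :* x :+ :- (a :* y)) ≋-refl a x y)
                     (≋-trans (+-cong ax≋ay ≋-refl) (≋cst0⇒≋𝟘 (solve 1 (λ z → z :+ :- z := con 0ℤ) ≋-refl (a * y))))

coeff-scale : ∀ α p d → coeffᵉ (cst α * p) d ≡ α ℤ.* coeffᵉ p d
coeff-scale α p d = trans (coeff-*ʳ (cst α) p d)
  (trans (ℤ.+-identityʳ _) (cong (λ e → α ℤ.* coeffᵉ p e) (-ᵉ-identityʳ d)))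

scaled-vanishes : ∀ {p F} α → Bounded p F → ∀ {E} → F <ᵉ E → coeffᵉ (cst α * p) E ≡ 0ℤ
scaled-vanishes {p} α p≤F {E} F<E =
  trans (coeff-scale α p E) (trans (cong (α ℤ.*_) (vanishes-above p≤F E F<E)) (ℤ.*-zeroʳ α))

scaled-top : ∀ {p E r} α → Leading p E → coeffᵉ r E ≡ 0ℤ → cst α * p + r ≋ 𝟘 → α ≡ 0ℤ
scaled-top {p} {E} {r} α (mkLeading _ p≢0) r≡0 sum≋0 =
  [ id , (λ p≡0 → contradiction p≡0 p≢0) ]′ (ℤ.i*j≡0⇒i≡0∨j≡0 α (begin
    α ℤ.* coeffᵉ p E                        ≡⟨ ℤ.+-identityʳ _ ⟨
    α ℤ.* coeffᵉ p E ℤ.+ 0ℤ                 ≡⟨ cong₂ ℤ._+_ (coeff-scale α p E) r≡0 ⟨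
    coeffᵉ (cst α * p) E ℤ.+ coeffᵉ r E     ≡⟨ coeff-+ (cst α * p) r E ⟨
    coeffᵉ (cst α * p + r) E                ≡⟨ coeff-≡ sum≋0 E ⟩
    0ℤ                                      ∎))
  where open ≡-Reasoning

drop-zero-scaled : ∀ {α} p {r} → α ≡ 0ℤ → cst α * p + r ≋ 𝟘 → r ≋ 𝟘
drop-zero-scaled p {r} refl sum≋0 = ≋-trans (≋-sym (+-cong (*-congˡ p cst-0) (≋-refl {r}))) sum≋0

scaled-independent₂ : ∀ {p q E F α β} → Leading p E → Leading q F → E ≢ F →
                      cst α * p + cst β * q ≋ 𝟘 → α ≡ 0ℤ × β ≡ 0ℤ
scaled-independent₂ {p} {q} {E} {F} {α} {β} p↑E q↑F E≢F sum≋0 with <ᵉ-cmp E F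
... | tri≈ _ E≡F _ = contradiction E≡F E≢F
... | tri> _ _ F<E = α≡0 , β≡0
  where
  α≡0 = scaled-top α p↑E (scaled-vanishes β (bounded q↑F) F<E) sum≋0
  β≡0 = scaled-top β q↑F refl (≋-trans (+-identityʳ _) (drop-zero-scaled p α≡0 sum≋0))
... | tri< E<F _ _ = α≡0 , β≡0
  where
  sum≋0′ = ≋-trans (+-comm (cst β * q) (cst α * p)) sum≋0
  β≡0 = scaled-top β q↑F (scaled-vanishes α (bounded p↑E) E<F) sum≋0′
  α≡0 = scaled-top α p↑E refl (≋-trans (+-identityʳ _) (drop-zero-scaled q β≡0 sum≋0′))

independent-below-top : ∀ {p q r E F G α β γ} → Leading p E → Leading q F → Leading r G →
                        F <ᵉ E → G <ᵉ E → F ≢ G → cst α * p + (cst β * q + cst γ * r) ≋ 𝟘 →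
                        α ≡ 0ℤ × β ≡ 0ℤ × γ ≡ 0ℤ
independent-below-top {p} {q} {r} {E} {α = α} {β} {γ} p↑E q↑F r↑G F<E G<E F≢G sum≋0 =
  α≡0 , scaled-independent₂ q↑F r↑G F≢G (drop-zero-scaled p α≡0 sum≋0)
  where
  rest-vanishes : coeffᵉ (cst β * q + cst γ * r) E ≡ 0ℤ
  rest-vanishes = trans (coeff-+ (cst β * q) (cst γ * r) E)
    (cong₂ ℤ._+_ (scaled-vanishes β (bounded q↑F) F<E) (scaled-vanishes γ (bounded r↑G) G<E))
  α≡0 = scaled-top α p↑E rest-vanishes sum≋0

scaled-independent₃ : ∀ {p q r E F G α β γ} → Leading p E → Leading q F → Leading r G →
                      E ≢ F → F ≢ G → E ≢ G → cst α * p + cst β * q + cst γ * r ≋ 𝟘 →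
                      α ≡ 0ℤ × β ≡ 0ℤ × γ ≡ 0ℤ
scaled-independent₃ {p} {q} {r} {E} {F} {G} {α} {β} {γ} p↑E q↑F r↑G E≢F F≢G E≢G sum≋0 =
  by-largest (<ᵉ-cmp E F) (<ᵉ-cmp F G) (<ᵉ-cmp E G)
  where
  x = cst α * p; y = cst β * q; z = cst γ * r

  E-largest : F <ᵉ E → G <ᵉ E → α ≡ 0ℤ × β ≡ 0ℤ × γ ≡ 0ℤ
  E-largest F<E G<E = independent-below-top p↑E q↑F r↑G F<E G<E F≢G (≋-trans (≋-sym (+-assoc x y z)) sum≋0)

  F-largest : E <ᵉ F → G <ᵉ F → α ≡ 0ℤ × β ≡ 0ℤ × γ ≡ 0ℤ
  F-largest E<F G<F =
    let β≡0 , α≡0 , γ≡0 = independent-below-top q↑F p↑E r↑G E<F G<F E≢G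
          (≋-trans (solve 3 (λ x y z → y :+ (x :+ z) := x :+ y :+ z) ≋-refl x y z) sum≋0)
    in α≡0 , β≡0 , γ≡0

  G-largest : E <ᵉ G → F <ᵉ G → α ≡ 0ℤ × β ≡ 0ℤ × γ ≡ 0ℤ
  G-largest E<G F<G =
    let γ≡0 , α≡0 , β≡0 = independent-below-top r↑G p↑E q↑F E<G F<G E≢F
          (≋-trans (solve 3 (λ x y z → z :+ (x :+ y) := x :+ y :+ z) ≋-refl x y z) sum≋0)
    in α≡0 , β≡0 , γ≡0

  by-largest : Tri (E <ᵉ F) (E ≡ F) (F <ᵉ E) → Tri (F <ᵉ G) (F ≡ G) (G <ᵉ F) → Tri (E <ᵉ G) (E ≡ G) (G <ᵉ E) →
               α ≡ 0ℤ × β ≡ 0ℤ × γ ≡ 0ℤ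
  by-largest (tri≈ _ E≡F _) _ _ = contradiction E≡F E≢F
  by-largest _ (tri≈ _ F≡G _) _ = contradiction F≡G F≢G
  by-largest _ _ (tri≈ _ E≡G _) = contradiction E≡G E≢G
  by-largest (tri> _ _ F<E) _ (tri> _ _ G<E) = E-largest F<E G<E
  by-largest (tri< E<F _ _) (tri> _ _ G<F) _ = F-largest E<F G<F
  by-largest _ (tri< F<G _ _) (tri< E<G _ _) = G-largest E<G F<G
  by-largest (tri< E<F _ _) (tri< F<G _ _) (tri> _ _ G<E) = contradiction (<ᵉ-trans E<F F<G) (<ᵉ-asym G<E)
  by-largest (tri> _ _ F<E) (tri> _ _ G<F) (tri< E<G _ _) = contradiction (<ᵉ-trans G<F F<E) (<ᵉ-asym E<G)

-- Leading exponents along mutations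

quad-leading : ∀ {u v U V} k → Leading u U → Bounded v V → V <ᵉ U → Leading (quad k u v) (U +ᵉ U)
quad-leading {u} {v} {U} {V} k (mkLeading u≤U u≢0) v≤V V<U =
  mkLeading (+-bounded (+-bounded uu≤ (bounded-mono kuv≤ (inj₁ kuv<))) (bounded-mono vv≤ (inj₁ vv<))) top≢0
  where
  uu≤ : Bounded (u * u) (U +ᵉ U)
  uu≤ = *-bounded u≤U u≤U
  kuv≤ : Bounded (nat k * u * v) (0ᵉ +ᵉ U +ᵉ V)
  kuv≤ = *-bounded (*-bounded (cst-bounded (+ k)) u≤U) v≤V
  kuv< : 0ᵉ +ᵉ U +ᵉ V <ᵉ U +ᵉ U
  kuv< = subst (λ W → W +ᵉ V <ᵉ U +ᵉ U) (sym (+ᵉ-identityˡ U)) (+ᵉ-monoʳ-< U V<U)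
  vv≤ : Bounded (v * v) (V +ᵉ V)
  vv≤ = *-bounded v≤V v≤V
  vv< : V +ᵉ V <ᵉ U +ᵉ U
  vv< = <ᵉ-trans (+ᵉ-monoˡ-< V V<U) (+ᵉ-monoʳ-< U V<U)
  top≢0 : coeffᵉ (quad k u v) (U +ᵉ U) ≢ 0ℤ
  top≢0 c≡0 = [ u≢0 , u≢0 ]′ (ℤ.i*j≡0⇒i≡0∨j≡0 _ (begin
    coeffᵉ u U ℤ.* coeffᵉ u U                                          ≡⟨ coeff-*-top u≤U u≤U ⟨
    coeffᵉ (u * u) (U +ᵉ U)                                            ≡⟨ ℤ.+-identityʳ _ ⟨
    coeffᵉ (u * u) (U +ᵉ U) ℤ.+ 0ℤ                                     ≡⟨ ℤ.+-identityʳ _ ⟨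
    coeffᵉ (u * u) (U +ᵉ U) ℤ.+ 0ℤ ℤ.+ 0ℤ
      ≡⟨ cong₂ (λ m n → coeffᵉ (u * u) (U +ᵉ U) ℤ.+ m ℤ.+ n)
               (vanishes-above kuv≤ _ kuv<) (vanishes-above vv≤ _ vv<) ⟨
    coeffᵉ (u * u) (U +ᵉ U) ℤ.+ coeffᵉ (nat k * u * v) (U +ᵉ U) ℤ.+ coeffᵉ (v * v) (U +ᵉ U)
      ≡⟨ cong (ℤ._+ coeffᵉ (v * v) (U +ᵉ U)) (coeff-+ (u * u) (nat k * u * v) (U +ᵉ U)) ⟨
    coeffᵉ (u * u + nat k * u * v) (U +ᵉ U) ℤ.+ coeffᵉ (v * v) (U +ᵉ U)
      ≡⟨ coeff-+ (u * u + nat k * u * v) (v * v) (U +ᵉ U) ⟨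
    coeffᵉ (quad k u v) (U +ᵉ U)                                       ≡⟨ c≡0 ⟩
    0ℤ                                                                 ∎))
    where open ≡-Reasoning

infixr 8 _·ᵉ_
_·ᵉ_ : ℤ → Exponent → Exponent
α ·ᵉ (a , b , c) = α ℤ.* a , α ℤ.* b , α ℤ.* c

record Independent (A B C : Exponent) : Set where
  constructor mkIndependent
  field only-trivial : ∀ α β γ → α ·ᵉ A +ᵉ β ·ᵉ B +ᵉ γ ·ᵉ C ≡ 0ᵉ → α ≡ 0ℤ × β ≡ 0ℤ × γ ≡ 0ℤ
open Independent public

independent-swap₁₂ : ∀ {A B C} → Independent A B C → Independent B A C
independent-swap₁₂ {A} {B} {C} (mkIndependent f) = mkIndependent λ α β γ rel →
  let β≡0 , α≡0 , γ≡0 = f β α γ (trans (cong (_+ᵉ γ ·ᵉ C) (+ᵉ-comm (β ·ᵉ A) (α ·ᵉ B))) rel)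
  in α≡0 , β≡0 , γ≡0

independent-swap₂₃ : ∀ {A B C} → Independent A B C → Independent A C B
independent-swap₂₃ {A} {B} {C} (mkIndependent f) = mkIndependent λ α β γ rel →
  let α≡0 , γ≡0 , β≡0 = f α γ β (trans (swap (α ·ᵉ A) (γ ·ᵉ B) (β ·ᵉ C)) rel)
  in α≡0 , β≡0 , γ≡0
  where
  swap : ∀ d e f → d +ᵉ e +ᵉ f ≡ d +ᵉ f +ᵉ e
  swap d e f = trans (+ᵉ-assoc d e f) (trans (cong (d +ᵉ_) (+ᵉ-comm e f)) (sym (+ᵉ-assoc d f e)))

independent⇒≢₁₂ : ∀ {A B C} → Independent A B C → A ≢ B
independent⇒≢₁₂ {A} {B} {C} (mkIndependent f) refl with f 1ℤ -1ℤ 0ℤ (cancels A C)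
  where
  cancels : ∀ A C → 1ℤ ·ᵉ A +ᵉ -1ℤ ·ᵉ A +ᵉ 0ℤ ·ᵉ C ≡ 0ᵉ
  cancels (a , b , c) (d , e , f) = triple-≡ (identity a d) (identity b e) (identity c f)
    where identity : ∀ a d → 1ℤ ℤ.* a ℤ.+ -1ℤ ℤ.* a ℤ.+ 0ℤ ℤ.* d ≡ 0ℤ
          identity = solve-∀
... | () , _

independent⇒≢₂₃ : ∀ {A B C} → Independent A B C → B ≢ C
independent⇒≢₂₃ = independent⇒≢₁₂ ∘ independent-swap₂₃ ∘ independent-swap₁₂

independent⇒≢₁₃ : ∀ {A B C} → Independent A B C → A ≢ C
independent⇒≢₁₃ = independent⇒≢₁₂ ∘ independent-swap₂₃

-- A relation α X' + β U + γ V = 0 with X' + X = 2U becomes -α X + (2α + β) U + γ V = 0.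
independent-reflect : ∀ {X X' U V} → X' +ᵉ X ≡ U +ᵉ U → Independent X U V → Independent X' U V
independent-reflect {X} {X'} {U} {V} X'+X≡2U (mkIndependent f) = mkIndependent λ α β γ rel →
  let -α≡0 , 2α+β≡0 , γ≡0 = f (ℤ.- α) (α ℤ.+ α ℤ.+ β) γ (transfer α β γ X X' U V X'+X≡2U rel)
      α≡0 = trans (sym (ℤ.neg-involutive α)) (cong ℤ.-_ -α≡0)
  in α≡0 , trans (sym (ℤ.+-identityˡ β)) (trans (cong (λ w → w ℤ.+ w ℤ.+ β) (sym α≡0)) 2α+β≡0) , γ≡0
  where
  transfer₁ : ∀ α β γ x x' u v → x' ℤ.+ x ≡ u ℤ.+ u → α ℤ.* x' ℤ.+ β ℤ.* u ℤ.+ γ ℤ.* v ≡ 0ℤ →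
              ℤ.- α ℤ.* x ℤ.+ (α ℤ.+ α ℤ.+ β) ℤ.* u ℤ.+ γ ℤ.* v ≡ 0ℤ
  transfer₁ α β γ x x' u v x'+x≡2u rel = begin
    ℤ.- α ℤ.* x ℤ.+ (α ℤ.+ α ℤ.+ β) ℤ.* u ℤ.+ γ ℤ.* v
      ≡⟨ identity α β γ x x' u v ⟩
    (α ℤ.* x' ℤ.+ β ℤ.* u ℤ.+ γ ℤ.* v) ℤ.+ α ℤ.* (u ℤ.+ u ℤ.- (x' ℤ.+ x))
      ≡⟨ cong₂ (λ r s → r ℤ.+ α ℤ.* (u ℤ.+ u ℤ.- s)) rel x'+x≡2u ⟩
    0ℤ ℤ.+ α ℤ.* (u ℤ.+ u ℤ.- (u ℤ.+ u))
      ≡⟨ cong (λ w → 0ℤ ℤ.+ α ℤ.* w) (ℤ.+-inverseʳ (u ℤ.+ u)) ⟩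
    0ℤ ℤ.+ α ℤ.* 0ℤ
      ≡⟨ trans (ℤ.+-identityˡ _) (ℤ.*-zeroʳ α) ⟩
    0ℤ ∎
    where
    open ≡-Reasoning
    identity : ∀ α β γ x x' u v → ℤ.- α ℤ.* x ℤ.+ (α ℤ.+ α ℤ.+ β) ℤ.* u ℤ.+ γ ℤ.* v
                                  ≡ (α ℤ.* x' ℤ.+ β ℤ.* u ℤ.+ γ ℤ.* v) ℤ.+ α ℤ.* (u ℤ.+ u ℤ.- (x' ℤ.+ x))
    identity = solve-∀
  transfer : ∀ α β γ X X' U V → X' +ᵉ X ≡ U +ᵉ U → α ·ᵉ X' +ᵉ β ·ᵉ U +ᵉ γ ·ᵉ V ≡ 0ᵉ →
             (ℤ.- α) ·ᵉ X +ᵉ (α ℤ.+ α ℤ.+ β) ·ᵉ U +ᵉ γ ·ᵉ V ≡ 0ᵉ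
  transfer α β γ (x₁ , x₂ , x₃) (y₁ , y₂ , y₃) (u₁ , u₂ , u₃) (v₁ , v₂ , v₃) eq rel =
    triple-≡ (transfer₁ α β γ x₁ y₁ u₁ v₁ (cong proj₁ eq) (cong proj₁ rel))
             (transfer₁ α β γ x₂ y₂ u₂ v₂ (cong (proj₁ ∘ proj₂) eq) (cong (proj₁ ∘ proj₂) rel))
             (transfer₁ α β γ x₃ y₃ u₃ v₃ (cong (proj₂ ∘ proj₂) eq) (cong (proj₂ ∘ proj₂) rel))

mutation-leading-ordered : ∀ k {x u v x' X U V} → Leading x X → Leading u U → Leading v V → Independent X U V →
                           V <ᵉ U → x' * x ≋ quad k u v → ∃ λ X' → Leading x' X' × Independent X' U V
mutation-leading-ordered k {x} {u} {v} {x'} {X} {U} x↑X u↑U v↑V ind V<U x'x≋q with zero-or-leading x'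
... | inj₁ x'≋0 = contradiction (coeff-≡ (≋-trans (≋-sym x'x≋q) (*-congˡ x x'≋0)) (U +ᵉ U)) (leading≢0 q↑2U)
  where q↑2U = quad-leading k u↑U (bounded v↑V) V<U
... | inj₂ (X' , x'↑X') = X' , x'↑X' , independent-reflect X'+X≡2U ind
  where X'+X≡2U = leading-unique (*-leading x'↑X' x↑X) (leading-≋ (≋-sym x'x≋q) (quad-leading k u↑U (bounded v↑V) V<U))

mutation-leading : ∀ k {x u v x' X U V} → Leading x X → Leading u U → Leading v V → Independent X U V →
                   x' * x ≋ quad k u v → ∃ λ X' → Leading x' X' × Independent X' U V
mutation-leading k {u = u} {v} {U = U} {V} x↑X u↑U v↑V ind x'x≋q with <ᵉ-cmp U V
... | tri≈ _ U≡V _ = contradiction U≡V (independent⇒≢₂₃ ind)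
... | tri> _ _ V<U = mutation-leading-ordered k x↑X u↑U v↑V ind V<U x'x≋q
... | tri< U<V _ _ =
  let X' , x'↑X' , ind' = mutation-leading-ordered k x↑X v↑V u↑U (independent-swap₂₃ ind) U<V
                            (≋-trans x'x≋q (quad-comm k u v))
  in X' , x'↑X' , independent-swap₂₃ ind'

cons-≋ : ∀ {t t' p q} → cf t ≡ cf t' → exponent t ≡ exponent t' → p ≋ q → t ∷ p ≋ t' ∷ q
cons-≋ {t} {t'} {p} {q} cf≡ exp≡ (mk≋ p≋q) = mk≋ λ d → begin
  coeffᵉ (t ∷ [] + p) d                       ≡⟨ coeff-+ (t ∷ []) p d ⟩
  coeffᵉ (t ∷ []) d ℤ.+ coeffᵉ p d            ≡⟨ cong₂ ℤ._+_ (coeff≡pairing-δ (t ∷ []) d) (p≋q d) ⟩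
  cf t ℤ.* δ d (exponent t) ℤ.+ 0ℤ ℤ.+ coeffᵉ q d
    ≡⟨ cong₂ (λ c e → c ℤ.* δ d e ℤ.+ 0ℤ ℤ.+ coeffᵉ q d) cf≡ exp≡ ⟩
  cf t' ℤ.* δ d (exponent t') ℤ.+ 0ℤ ℤ.+ coeffᵉ q d
    ≡⟨ cong (ℤ._+ coeffᵉ q d) (coeff≡pairing-δ (t' ∷ []) d) ⟨
  coeffᵉ (t' ∷ []) d ℤ.+ coeffᵉ q d           ≡⟨ coeff-+ (t' ∷ []) q d ⟨
  coeffᵉ (t' ∷ [] + q) d                      ∎
  where open ≡-Reasoning

-- Both sides are the same six monomials in the same order, up to the coefficients k i · 1.
markov-base : ∀ k → 𝓜 k * (x₁ * x₂ * x₃) ≋ markovForm (k 0F) (k 1F) (k 2F) x₁ x₂ x₃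
markov-base k = cons-≋ refl refl (cons-≋ refl refl (cons-≋ refl refl
  (cons-≋ (unit (k 0F)) refl (cons-≋ (unit (k 1F)) refl (cons-≋ (unit (k 2F)) refl ≋-refl)))))
  where unit : ∀ n → + n ℤ.* 1ℤ ≡ + n ℤ.* 1ℤ ℤ.* 1ℤ
        unit n = sym (ℤ.*-identityʳ (+ n ℤ.* 1ℤ))

-- Vieta: a and a' are the two roots of the Markov relation viewed as a quadratic in its first entry.
markovRel-exchange : ∀ {M n₁ n₂ n₃ a b c a' A} → Leading a A → a' * a ≋ quad n₁ b c →
                     MarkovRel M n₁ n₂ n₃ a b c → MarkovRel M n₁ n₂ n₃ a' b c
markovRel-exchange {M} {n₁} {n₂} {n₃} {a} {b} {c} {a'} a↑A a'a≋q (markovRel rel) = markovRel (*-cancelˡ a↑A (begin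
  a * (M * (a' * b * c))
    ≈⟨ solve 5 (λ M a b c a' → a :* (M :* (a' :* b :* c)) := a' :* (M :* (a :* b :* c))) ≋-refl M a b c a' ⟩
  a' * (M * (a * b * c))
    ≈⟨ *-congʳ a' rel ⟩
  a' * markovForm n₁ n₂ n₃ a b c
    ≈⟨ solve 7 (λ N₁ N₂ N₃ a b c a' →
         a' :* (a :* a :+ b :* b :+ c :* c :+ N₁ :* b :* c :+ N₂ :* a :* c :+ N₃ :* a :* b) :=
         a :* (a' :* a' :+ b :* b :+ c :* c :+ N₁ :* b :* c :+ N₂ :* a' :* c :+ N₃ :* a' :* b)
         :+ (a' :+ :- a) :* ((b :* b :+ N₁ :* b :* c :+ c :* c) :+ :- (a' :* a)))
         ≋-refl (nat n₁) (nat n₂) (nat n₃) a b c a' ⟩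
  a * markovForm n₁ n₂ n₃ a' b c + (a' + - a) * (quad n₁ b c + - (a' * a))
    ≈⟨ +-cong (≋-refl {a * markovForm n₁ n₂ n₃ a' b c}) (*-congʳ (a' + - a) (+-cong (≋-sym a'a≋q) ≋-refl)) ⟩
  a * markovForm n₁ n₂ n₃ a' b c + (a' + - a) * (a' * a + - (a' * a))
    ≈⟨ solve 3 (λ X d e → X :+ d :* (e :+ :- e) := X) ≋-refl (a * markovForm n₁ n₂ n₃ a' b c) (a' + - a) (a' * a) ⟩
  a * markovForm n₁ n₂ n₃ a' b c ∎))
  where open ≈-Reasoning laurentSetoid

monomial-leading : ∀ c e₁ e₂ e₃ → c ≢ 0ℤ → Leading (term c e₁ e₂ e₃ ∷ []) (e₁ , e₂ , e₃)
monomial-leading c e₁ e₂ e₃ c≢0 = mkLeading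
  (mkBounded λ d e<d → trans (coeff≡pairing-δ (term c e₁ e₂ e₃ ∷ []) d)
    (trans (cong (λ w → c ℤ.* w ℤ.+ 0ℤ) (δ-off (<ᵉ⇒≢ e<d))) (trans (ℤ.+-identityʳ _) (ℤ.*-zeroʳ c))))
  (λ c'≡0 → c≢0 (begin
    c                                   ≡⟨ trans (sym (ℤ.*-identityʳ c)) (sym (ℤ.+-identityʳ _)) ⟩
    c ℤ.* 1ℤ ℤ.+ 0ℤ                     ≡⟨ cong (λ w → c ℤ.* w ℤ.+ 0ℤ) (δ-diag (e₁ , e₂ , e₃)) ⟨
    c ℤ.* δ (e₁ , e₂ , e₃) (e₁ , e₂ , e₃) ℤ.+ 0ℤ
                                        ≡⟨ coeff≡pairing-δ (term c e₁ e₂ e₃ ∷ []) _ ⟨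
    coeffᵉ (term c e₁ e₂ e₃ ∷ []) (e₁ , e₂ , e₃) ≡⟨ c'≡0 ⟩
    0ℤ                                  ∎))
  where open ≡-Reasoning

independent-units : Independent (1ℤ , 0ℤ , 0ℤ) (0ℤ , 1ℤ , 0ℤ) (0ℤ , 0ℤ , 1ℤ)
independent-units = mkIndependent λ α β γ rel →
  trans (sym (first α β γ)) (cong proj₁ rel) ,
  trans (sym (second α β γ)) (cong (proj₁ ∘ proj₂) rel) ,
  trans (sym (third α β γ)) (cong (proj₂ ∘ proj₂) rel)
  where
  first : ∀ α β γ → α ℤ.* 1ℤ ℤ.+ β ℤ.* 0ℤ ℤ.+ γ ℤ.* 0ℤ ≡ α
  first = solve-∀
  second : ∀ α β γ → α ℤ.* 0ℤ ℤ.+ β ℤ.* 1ℤ ℤ.+ γ ℤ.* 0ℤ ≡ β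
  second = solve-∀
  third : ∀ α β γ → α ℤ.* 0ℤ ℤ.+ β ℤ.* 0ℤ ℤ.+ γ ℤ.* 1ℤ ≡ γ
  third = solve-∀

record ClusterInvariant (k : Params) (s : Triple) : Set where
  field
    A₀ A₁ A₂ : Exponent
    leading₀ : Leading (s 0F) A₀
    leading₁ : Leading (s 1F) A₁
    leading₂ : Leading (s 2F) A₂
    independent : Independent A₀ A₁ A₂
    markov : MarkovRel (𝓜 k) (k 0F) (k 1F) (k 2F) (s 0F) (s 1F) (s 2F)
open ClusterInvariant

reach⇒invariant : ∀ {k s} → Reach k s → ClusterInvariant k s
reach⇒invariant {k} base = record
  { leading₀ = monomial-leading 1ℤ 1ℤ 0ℤ 0ℤ (λ ())
  ; leading₁ = monomial-leading 1ℤ 0ℤ 1ℤ 0ℤ (λ ())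
  ; leading₂ = monomial-leading 1ℤ 0ℤ 0ℤ 1ℤ (λ ())
  ; independent = independent-units
  ; markov = markovRel (markov-base k) }
reach⇒invariant {k} (mut₁ a' r a'a≈q) = record
  { leading₀ = proj₁ (proj₂ new) ; leading₁ = leading₁ ih ; leading₂ = leading₂ ih
  ; independent = proj₂ (proj₂ new)
  ; markov = markovRel-exchange (leading₀ ih) (≈⇒≋ a'a≈q) (markov ih) }
  where
  ih = reach⇒invariant r
  new = mutation-leading (k 0F) (leading₀ ih) (leading₁ ih) (leading₂ ih) (independent ih) (≈⇒≋ a'a≈q)
reach⇒invariant {k} (mut₂ b' r b'b≈q) = record
  { leading₀ = leading₀ ih ; leading₁ = proj₁ (proj₂ new) ; leading₂ = leading₂ ih
  ; independent = independent-swap₁₂ (proj₂ (proj₂ new))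
  ; markov = markovRel-swap₁₂ (markovRel-exchange (leading₁ ih) (≈⇒≋ b'b≈q) (markovRel-swap₁₂ (markov ih))) }
  where
  ih = reach⇒invariant r
  new = mutation-leading (k 1F) (leading₁ ih) (leading₀ ih) (leading₂ ih)
                         (independent-swap₁₂ (independent ih)) (≈⇒≋ b'b≈q)
reach⇒invariant {k} (mut₃ {a} {b} c' r c'c≈q) = record
  { leading₀ = leading₀ ih ; leading₁ = leading₁ ih ; leading₂ = proj₁ (proj₂ new)
  ; independent = independent-swap₁₂ (independent-swap₂₃ (independent-swap₁₂ (proj₂ (proj₂ new))))
  ; markov = markovRel-swap₁₃ (markovRel-exchange (leading₂ ih) c'c≋q′ (markovRel-swap₁₃ (markov ih))) }
  where
  ih = reach⇒invariant r
  c'c≋q′ = ≋-trans (≈⇒≋ c'c≈q) (quad-comm (k 2F) a b)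
  new = mutation-leading (k 2F) (leading₂ ih) (leading₁ ih) (leading₀ ih)
                         (independent-swap₁₂ (independent-swap₂₃ (independent-swap₁₂ (independent ih)))) c'c≋q′

nat-difference : ∀ m n → nat m + - nat n ≋ cst (+ m ℤ.- + n)
nat-difference m n = ≋-sym (≋-trans (cst-+ (+ m) (ℤ.- + n)) (+-cong (≋-refl {nat m}) (cst-neg (+ n))))

-- Two Markov relations for the same cluster differ by a ℤ-combination of bc, ac, ab, whose leading
-- exponents A₁+A₂, A₀+A₂, A₀+A₁ are distinct.
parameters-determined : ∀ {k s} n₁ n₂ n₃ → ClusterInvariant k s → MarkovRel (𝓜 k) n₁ n₂ n₃ (s 0F) (s 1F) (s 2F) →
                        k 0F ≡ n₁ × k 1F ≡ n₂ × k 2F ≡ n₃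
parameters-determined {k} {s} n₁ n₂ n₃ ci (markovRel rel) =
  let d₁≡0 , d₂≡0 , d₃≡0 = scaled-independent₃ (*-leading (leading₁ ci) (leading₂ ci))
                             (*-leading (leading₀ ci) (leading₂ ci)) (*-leading (leading₀ ci) (leading₁ ci))
                             (λ eq → A₀≢A₁ (sym (+ᵉ-cancelʳ-≡ (A₂ ci) eq)))
                             (λ eq → A₁≢A₂ (sym (+ᵉ-cancelʳ-≡ (A₀ ci)
                                       (trans (+ᵉ-comm (A₂ ci) (A₀ ci)) (trans eq (+ᵉ-comm (A₀ ci) (A₁ ci)))))))
                             (λ eq → A₀≢A₂ (sym (+ᵉ-cancelʳ-≡ (A₁ ci) (trans (+ᵉ-comm (A₂ ci) (A₁ ci)) eq))))
                             combination≋0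
  in same d₁≡0 , same d₂≡0 , same d₃≡0
  where
  a = s 0F; b = s 1F; c = s 2F
  A₀≢A₁ = independent⇒≢₁₂ (independent ci)
  A₁≢A₂ = independent⇒≢₂₃ (independent ci)
  A₀≢A₂ = independent⇒≢₁₃ (independent ci)
  same : ∀ {m n} → + m ℤ.- + n ≡ 0ℤ → m ≡ n
  same {m} {n} eq = ℤ.+-injective (ℤ.i-j≡0⇒i≡j (+ m) (+ n) eq)
  combination≋0 : cst (+ k 0F ℤ.- + n₁) * (b * c) + cst (+ k 1F ℤ.- + n₂) * (a * c)
                  + cst (+ k 2F ℤ.- + n₃) * (a * b) ≋ 𝟘
  combination≋0 = begin
    cst (+ k 0F ℤ.- + n₁) * (b * c) + cst (+ k 1F ℤ.- + n₂) * (a * c) + cst (+ k 2F ℤ.- + n₃) * (a * b)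
      ≈⟨ +-cong (+-cong (*-congˡ (b * c) (nat-difference (k 0F) n₁)) (*-congˡ (a * c) (nat-difference (k 1F) n₂)))
                (*-congˡ (a * b) (nat-difference (k 2F) n₃)) ⟨
    (nat (k 0F) + - nat n₁) * (b * c) + (nat (k 1F) + - nat n₂) * (a * c) + (nat (k 2F) + - nat n₃) * (a * b)
      ≈⟨ solve 9 (λ a b c K₁ K₂ K₃ N₁ N₂ N₃ →
           (K₁ :+ :- N₁) :* (b :* c) :+ (K₂ :+ :- N₂) :* (a :* c) :+ (K₃ :+ :- N₃) :* (a :* b) :=
           (a :* a :+ b :* b :+ c :* c :+ K₁ :* b :* c :+ K₂ :* a :* c :+ K₃ :* a :* b)
           :+ :- (a :* a :+ b :* b :+ c :* c :+ N₁ :* b :* c :+ N₂ :* a :* c :+ N₃ :* a :* b))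
           ≋-refl a b c (nat (k 0F)) (nat (k 1F)) (nat (k 2F)) (nat n₁) (nat n₂) (nat n₃) ⟩
    markovForm (k 0F) (k 1F) (k 2F) a b c + - markovForm n₁ n₂ n₃ a b c
      ≈⟨ +-cong (≋-trans (≋-sym (markov-≋ (markov ci))) rel) ≋-refl ⟩
    markovForm n₁ n₂ n₃ a b c + - markovForm n₁ n₂ n₃ a b c
      ≈⟨ ≋cst0⇒≋𝟘 (solve 1 (λ x → x :+ :- x := con 0ℤ) ≋-refl (markovForm n₁ n₂ n₃ a b c)) ⟩
    𝟘 ∎
    where open ≈-Reasoning laurentSetoid

-- Exchanging an entry of a non-labeled cluster

other₁ other₂ : Fin 3 → Fin 3
other₁ 0F = 1F
other₁ 1F = 0F
other₁ 2F = 0F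
other₂ 0F = 2F
other₂ 1F = 2F
other₂ 2F = 1F

other₁≢ : ∀ l → other₁ l ≢ l
other₁≢ 0F ()
other₁≢ 1F ()
other₁≢ 2F ()

other₂≢ : ∀ l → other₂ l ≢ l
other₂≢ 0F ()
other₂≢ 1F ()
other₂≢ 2F ()

other₁≢other₂ : ∀ l → other₁ l ≢ other₂ l
other₁≢other₂ 0F ()
other₁≢other₂ 1F ()
other₁≢other₂ 2F ()

complement : ∀ {l m₁ m₂} → m₁ ≢ l → m₂ ≢ l → m₁ ≢ m₂ →
             (m₁ ≡ other₁ l × m₂ ≡ other₂ l) ⊎ (m₁ ≡ other₂ l × m₂ ≡ other₁ l)
complement {0F} {1F} {2F} _ _ _ = inj₁ (refl , refl)
complement {0F} {2F} {1F} _ _ _ = inj₂ (refl , refl)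
complement {1F} {0F} {2F} _ _ _ = inj₁ (refl , refl)
complement {1F} {2F} {0F} _ _ _ = inj₂ (refl , refl)
complement {2F} {0F} {1F} _ _ _ = inj₁ (refl , refl)
complement {2F} {1F} {0F} _ _ _ = inj₂ (refl , refl)
complement {0F} {0F} m₁≢l _ _ = contradiction refl m₁≢l
complement {1F} {1F} m₁≢l _ _ = contradiction refl m₁≢l
complement {2F} {2F} m₁≢l _ _ = contradiction refl m₁≢l
complement {0F} {_} {0F} _ m₂≢l _ = contradiction refl m₂≢l
complement {1F} {_} {1F} _ m₂≢l _ = contradiction refl m₂≢l
complement {2F} {_} {2F} _ m₂≢l _ = contradiction refl m₂≢l
complement {_} {0F} {0F} _ _ m₁≢m₂ = contradiction refl m₁≢m₂
complement {_} {1F} {1F} _ _ m₁≢m₂ = contradiction refl m₁≢m₂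
complement {_} {2F} {2F} _ _ m₁≢m₂ = contradiction refl m₁≢m₂

quad-complement : ∀ n (t : Triple) l {m₁ m₂} → m₁ ≢ l → m₂ ≢ l → m₁ ≢ m₂ →
                  quad n (t (other₁ l)) (t (other₂ l)) ≋ quad n (t m₁) (t m₂)
quad-complement n t l m₁≢l m₂≢l m₁≢m₂ with complement m₁≢l m₂≢l m₁≢m₂
... | inj₁ (refl , refl) = ≋-refl
... | inj₂ (refl , refl) = quad-comm n (t (other₁ l)) (t (other₂ l))

markovRel-arrange : ∀ {M} (n : Fin 3 → ℕ) (t : Triple) {i j l} → j ≢ i → l ≢ i → j ≢ l →
                    MarkovRel M (n 0F) (n 1F) (n 2F) (t 0F) (t 1F) (t 2F) →
                    MarkovRel M (n i) (n j) (n l) (t i) (t j) (t l)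
markovRel-arrange n t {0F} j≢i l≢i j≢l rel with complement j≢i l≢i j≢l
... | inj₁ (refl , refl) = rel
... | inj₂ (refl , refl) = markovRel-swap₂₃ rel
markovRel-arrange n t {1F} j≢i l≢i j≢l rel with complement j≢i l≢i j≢l
... | inj₁ (refl , refl) = markovRel-swap₁₂ rel
... | inj₂ (refl , refl) = markovRel-swap₂₃ (markovRel-swap₁₂ rel)
markovRel-arrange n t {2F} j≢i l≢i j≢l rel with complement j≢i l≢i j≢l
... | inj₁ (refl , refl) = markovRel-swap₂₃ (markovRel-swap₁₃ rel)
... | inj₂ (refl , refl) = markovRel-swap₁₃ rel

update : Triple → Fin 3 → Laurent → Triple
update s 0F x = triple x (s 1F) (s 2F)
update s 1F x = triple (s 0F) x (s 2F)
update s 2F x = triple (s 0F) (s 1F) x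

update-≡ : ∀ s j x → update s j x j ≡ x
update-≡ s 0F x = refl
update-≡ s 1F x = refl
update-≡ s 2F x = refl

update-≢ : ∀ s j x {i} → i ≢ j → update s j x i ≡ s i
update-≢ s 0F x {0F} i≢j = contradiction refl i≢j
update-≢ s 0F x {1F} _ = refl
update-≢ s 0F x {2F} _ = refl
update-≢ s 1F x {0F} _ = refl
update-≢ s 1F x {1F} i≢j = contradiction refl i≢j
update-≢ s 1F x {2F} _ = refl
update-≢ s 2F x {0F} _ = refl
update-≢ s 2F x {1F} _ = refl
update-≢ s 2F x {2F} i≢j = contradiction refl i≢j

reach-η : ∀ {k s} → Reach k s → Reach k (triple (s 0F) (s 1F) (s 2F))
reach-η base = base
reach-η (mut₁ a' r eq) = mut₁ a' r eq
reach-η (mut₂ b' r eq) = mut₂ b' r eq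
reach-η (mut₃ c' r eq) = mut₃ c' r eq

reach-update : ∀ {k s} j x → Reach k s → x * s j ≋ quad (k j) (s (other₁ j)) (s (other₂ j)) → Reach k (update s j x)
reach-update 0F x r eq = mut₁ x (reach-η r) (≋⇒≈ eq)
reach-update 1F x r eq = mut₂ x (reach-η r) (≋⇒≈ eq)
reach-update 2F x r eq = mut₃ x (reach-η r) (≋⇒≈ eq)

⟨$⟩ʳ-injective : ∀ (σ : Permutation′ 3) {i i'} → σ ⟨$⟩ʳ i ≡ σ ⟨$⟩ʳ i' → i ≡ i'
⟨$⟩ʳ-injective σ eq = trans (sym (inverseˡ σ)) (trans (cong (σ ⟨$⟩ˡ_) eq) (inverseˡ σ))

-- The Markov relation for t pins down the parameters of the labeled cluster s, so an exchange relation
-- for an entry of t with parameter nn is a mutation of s.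
module ClusterExchange {k : Params} {t : Triple} (nn : Fin 3 → ℕ) (σ : Permutation′ 3) (s : Triple) (r : Reach k s)
                       (s≈t∘σ : ∀ i → s i ≈ t (σ ⟨$⟩ʳ i))
                       (rel : MarkovRel (𝓜 k) (nn 0F) (nn 1F) (nn 2F) (t 0F) (t 1F) (t 2F)) where

  s≋t∘σ : ∀ i → s i ≋ t (σ ⟨$⟩ʳ i)
  s≋t∘σ i = ≈⇒≋ {s i} {t (σ ⟨$⟩ʳ i)} (s≈t∘σ i)

  σ-≢ : ∀ {i i'} → i ≢ i' → σ ⟨$⟩ʳ i ≢ σ ⟨$⟩ʳ i'
  σ-≢ i≢i' = i≢i' ∘ ⟨$⟩ʳ-injective σ

  s-markov : MarkovRel (𝓜 k) (nn (σ ⟨$⟩ʳ 0F)) (nn (σ ⟨$⟩ʳ 1F)) (nn (σ ⟨$⟩ʳ 2F)) (s 0F) (s 1F) (s 2F)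
  s-markov = markovRel-cong (≋-sym (s≋t∘σ 0F)) (≋-sym (s≋t∘σ 1F)) (≋-sym (s≋t∘σ 2F))
               (markovRel-arrange nn t (σ-≢ (λ ())) (σ-≢ (λ ())) (σ-≢ (λ ())) rel)

  determined : k 0F ≡ nn (σ ⟨$⟩ʳ 0F) × k 1F ≡ nn (σ ⟨$⟩ʳ 1F) × k 2F ≡ nn (σ ⟨$⟩ʳ 2F)
  determined = parameters-determined (nn (σ ⟨$⟩ʳ 0F)) (nn (σ ⟨$⟩ʳ 1F)) (nn (σ ⟨$⟩ʳ 2F)) (reach⇒invariant r) s-markov

  k≡nn∘σ : ∀ i → k i ≡ nn (σ ⟨$⟩ʳ i)
  k≡nn∘σ 0F = proj₁ determined
  k≡nn∘σ 1F = proj₁ (proj₂ determined)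
  k≡nn∘σ 2F = proj₂ (proj₂ determined)

  exchange : ∀ l {x} → x * t l ≋ quad (nn l) (t (other₁ l)) (t (other₂ l)) →
             ∀ (τ : Permutation′ 3) t' → (∀ i → i ≢ l → t' (τ ⟨$⟩ʳ i) ≋ t i) → t' (τ ⟨$⟩ʳ l) ≋ x →
             NonLabeledCluster k t' × Parity k x (nn l)
  exchange l {x} xt≋q τ t' t'∘τ≋t t'∘τ≋x = (σ ∘ₚ τ , s' , reach' , λ i → ≋⇒≈ (s'≋t'∘τ∘σ i)) , (j , occurs , kj≡nnl)
    where
    j = σ ⟨$⟩ˡ l
    σj≡l : σ ⟨$⟩ʳ j ≡ l
    σj≡l = inverseʳ σ
    kj≡nnl : k j ≡ nn l
    kj≡nnl = trans (k≡nn∘σ j) (cong nn σj≡l)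
    away : ∀ {i} → i ≢ j → σ ⟨$⟩ʳ i ≢ l
    away i≢j σi≡l = σ-≢ i≢j (trans σi≡l (sym σj≡l))
    s-exchange : x * s j ≋ quad (k j) (s (other₁ j)) (s (other₂ j))
    s-exchange = begin
      x * s j
        ≈⟨ *-congʳ x (≋-trans (s≋t∘σ j) (≡⇒≋ (cong t σj≡l))) ⟩
      x * t l
        ≈⟨ xt≋q ⟩
      quad (nn l) (t (other₁ l)) (t (other₂ l))
        ≈⟨ quad-complement (nn l) t l (away (other₁≢ j)) (away (other₂≢ j)) (σ-≢ (other₁≢other₂ j)) ⟩
      quad (nn l) (t (σ ⟨$⟩ʳ other₁ j)) (t (σ ⟨$⟩ʳ other₂ j))
        ≈⟨ quad-cong (nn l) (s≋t∘σ (other₁ j)) (s≋t∘σ (other₂ j)) ⟨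
      quad (nn l) (s (other₁ j)) (s (other₂ j))
        ≡⟨ cong (λ n → quad n (s (other₁ j)) (s (other₂ j))) kj≡nnl ⟨
      quad (k j) (s (other₁ j)) (s (other₂ j)) ∎
      where open ≈-Reasoning laurentSetoid
    s' = update s j x
    reach' = reach-update j x r s-exchange
    s'≋t'∘τ∘σ : ∀ i → s' i ≋ t' (τ ⟨$⟩ʳ (σ ⟨$⟩ʳ i))
    s'≋t'∘τ∘σ i with i Fin.≟ j
    ... | yes refl = ≋-trans (≡⇒≋ (update-≡ s j x)) (≋-sym (subst (λ m → t' (τ ⟨$⟩ʳ m) ≋ x) (sym σj≡l) t'∘τ≋x))
    ... | no i≢j = ≋-trans (≡⇒≋ (update-≢ s j x i≢j)) (≋-trans (s≋t∘σ i) (≋-sym (t'∘τ≋t (σ ⟨$⟩ʳ i) (away i≢j))))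
    occurs : OccursAt k x j
    occurs = s' , (s' , reach' , λ _ _ _ _ → refl) , ≋⇒≈ (≡⇒≋ (update-≡ s j x))

cmm⇒SL₂Tr : ∀ {k X} (cmm : IsCMM k X) → SL₂Tr (proj₁ (proj₂ cmm)) X
cmm⇒SL₂Tr {X = X} (det≈1 , n , _ , tr≈-n) = record { det≋𝟙 = ≈⇒≋ {det X} {𝟙} det≈1 ; tr≋-n = ≈⇒≋ {tr X} { - nat n} tr≈-n }

SL₂Tr⇒cmm : ∀ {k n X} → SL₂Tr n X → Parity k (m₁₂ X) n → IsCMM k X
SL₂Tr⇒cmm {n = n} sX parity = ≋⇒≈ (det≋𝟙 sX) , n , parity , ≋⇒≈ (tr≋-n sX)

parity-≋ : ∀ {k y y' n} → Parity k y n → y ≋ y' → Parity k y' n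
parity-≋ {y = y} (i , (t , labeled , ti≈y) , ki≡n) y≋y' =
  i , (t , labeled , ≋⇒≈ (≋-trans (≈⇒≋ {t i} {y} ti≈y) y≋y')) , ki≡n

theorem5p6 : (k : Params) (X Y Z : M2) (a b c : Laurent) →
    IsCMMTriple k X Y Z →
    m₁₂ X ≈ a → m₁₂ Y ≈ b → m₁₂ Z ≈ c →
    (∃ λ n → Parity k c n ×
      (m₁₂ (Y · Z · inv Y) * c ≈ quad n a b) × (tr (Y · Z · inv Y) ≈ - nat n)) ×
    (∃ λ n → Parity k a n ×
      (m₁₂ (inv Y · X · Y) * a ≈ quad n b c) × (tr (inv Y · X · Y) ≈ - nat n)) ×
    InSL2 (Y · Z · inv Y) × InSL2 (inv Y · X · Y) ×
    IsCMMTriple k X (Y · Z · inv Y) Y × IsCMMTriple k Y (inv Y · X · Y) Z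
theorem5p6 k X Y Z a b c (cmmX , cmmY , cmmZ , XYZ≈T , σ , s , r , s≈t∘σ) X₁₂≈a Y₁₂≈b Z₁₂≈c =
  (nZ , parity-≋ parityZ Z₁₂≋c , ≋⇒≈ c'c≋q , ≋⇒≈ (tr≋-n conj-SL₂Tr)) ,
  (nX , parity-≋ parityX X₁₂≋a , ≋⇒≈ a'a≋q , ≋⇒≈ (tr≋-n conj⁻¹-SL₂Tr)) ,
  ≋⇒≈ (det≋𝟙 conj-SL₂Tr) , ≋⇒≈ (det≋𝟙 conj⁻¹-SL₂Tr) ,
  (cmmX , SL₂Tr⇒cmm conj-SL₂Tr (proj₂ c'-step) , cmmY , ≋ᴹ⇒≈M conj-triple-product , proj₁ c'-step) ,
  (cmmY , SL₂Tr⇒cmm conj⁻¹-SL₂Tr (proj₂ a'-step) , cmmZ , ≋ᴹ⇒≈M conj⁻¹-triple-product , proj₁ a'-step)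
  where
  nX = proj₁ (proj₂ cmmX); parityX = proj₁ (proj₂ (proj₂ cmmX))
  nY = proj₁ (proj₂ cmmY)
  nZ = proj₁ (proj₂ cmmZ); parityZ = proj₁ (proj₂ (proj₂ cmmZ))
  open CMMRelations {k} (cmm⇒SL₂Tr {k} {X} cmmX) (cmm⇒SL₂Tr {k} {Y} cmmY) (cmm⇒SL₂Tr {k} {Z} cmmZ)
                    (≈M⇒≋ᴹ {X · Y · Z} {Tmat k} XYZ≈T)
  X₁₂≋a = ≈⇒≋ {m₁₂ X} {a} X₁₂≈a
  Y₁₂≋b = ≈⇒≋ {m₁₂ Y} {b} Y₁₂≈b
  Z₁₂≋c = ≈⇒≋ {m₁₂ Z} {c} Z₁₂≈c
  parameters : Fin 3 → ℕ
  parameters 0F = nX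
  parameters 1F = nY
  parameters 2F = nZ
  open ClusterExchange {k} {t = triple (m₁₂ X) (m₁₂ Y) (m₁₂ Z)} parameters σ s r s≈t∘σ markovRel-cmm
  c'c≋q = ≋-trans (*-congʳ (m₁₂ (Y · Z · inv Y)) (≋-sym Z₁₂≋c)) (≋-trans conj-exchange (quad-cong nZ X₁₂≋a Y₁₂≋b))
  a'a≋q = ≋-trans (*-congʳ (m₁₂ (inv Y · X · Y)) (≋-sym X₁₂≋a)) (≋-trans conj⁻¹-exchange (quad-cong nX Y₁₂≋b Z₁₂≋c))
  c'-step = exchange 2F conj-exchange (transpose 1F 2F) (triple (m₁₂ X) (m₁₂ (Y · Z · inv Y)) (m₁₂ Y))
              (λ { 0F _ → ≋-refl ; 1F _ → ≋-refl ; 2F 2≢2 → contradiction refl 2≢2 }) ≋-refl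
  a'-step = exchange 0F conj⁻¹-exchange (transpose 0F 1F) (triple (m₁₂ Y) (m₁₂ (inv Y · X · Y)) (m₁₂ Z))
              (λ { 0F 0≢0 → contradiction refl 0≢0 ; 1F _ → ≋-refl ; 2F _ → ≋-refl }) ≋-refl
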